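{- For any integers $k>m>0$, $F_{[k,m]}(x)=R_k(x)$.
   Context: A permutation $\alpha\in S_n$ contains a pattern $\tau\in S_k$ if there are indices $1\le i_1<\dots<i_k\le n$ with $(\alpha_{i_1},\dots,\alpha_{i_k})$ order-isomorphic to $\tau$; otherwise it avoids $\tau$. For a pattern $\tau$, $f_\tau(n)$ is the number of permutations in $S_n$ avoiding both $132$ and $\tau$ ($S_0$ consists of the empty permutation), and $F_\tau(x)=\sum_{n\ge0}f_\tau(n)x^n$. For $k>m>0$, $[k,m]$ denotes the permutation $(m+1,m+2,\dots,k,1,2,\dots,m)\in S_k$. $U_p$ is the Chebyshev polynomial of the second kind, $U_p(\cos\theta)=\sin((p+1)\theta)/\sin\theta$, and $R_p(x)=\dfrac{U_{p-1}\left(\frac1{2\sqrt x}\right)}{\sqrt x\,U_p\left(\frac1{2\sqrt x}\right)}$ (a rational function of $x$). -}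

module Defs where

open import Data.Nat using (ℕ; zero; suc; _∸_; _≤ᵇ_; _<ᵇ_; _*_; _+_)
open import Data.Bool using (Bool; true; false; _∧_; if_then_else_)
open import Data.Bool.Properties using () renaming (_≟_ to _≟ᵇ_)
open import Data.List using (List; []; _∷_; _++_; map; concatMap; length; filterᵇ; zip; upTo)
open import Data.Bool.ListAction using (all; any)
open import Data.Product using (_×_; _,_; proj₁; proj₂)
open import Data.Integer using (ℤ; +_; -_) renaming (_+_ to _+ℤ_; _*_ to _*ℤ_; _-_ to _-ℤ_)
open import Relation.Nullary.Decidable using (does)

-- Permutations of S_n, represented as lists (one-line notation) of the
-- values 0,…,n-1 (order isomorphism makes the value offset irrelevant).

insertions : ℕ → List ℕ → List (List ℕ)
insertions x []       = (x ∷ []) ∷ []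
insertions x (y ∷ ys) = (x ∷ y ∷ ys) ∷ map (y ∷_) (insertions x ys)

perms : ℕ → List (List ℕ)
perms zero    = [] ∷ []
perms (suc n) = concatMap (insertions n) (perms n)

subseqs : {A : Set} → List A → List (List A)
subseqs []       = [] ∷ []
subseqs (x ∷ xs) = map (x ∷_) (subseqs xs) ++ subseqs xs

_==ᵇ_ : Bool → Bool → Bool
a ==ᵇ b = does (a ≟ᵇ b)

_==ℕ_ : ℕ → ℕ → Bool
a ==ℕ b = (a ≤ᵇ b) ∧ (b ≤ᵇ a)

orderIso : List ℕ → List ℕ → Bool
orderIso a b =
  (length a ==ℕ length b) ∧
  all (λ p → all (λ q → (proj₁ p <ᵇ proj₁ q) ==ᵇ (proj₂ p <ᵇ proj₂ q)) l) l
  where l = zip a b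

contains : List ℕ → List ℕ → Bool
contains α τ = any (λ s → orderIso s τ) (subseqs α)

avoids : List ℕ → List ℕ → Bool
avoids α τ = if contains α τ then false else true

p132 : List ℕ
p132 = 1 ∷ 3 ∷ 2 ∷ []

-- [k,m] = (m+1, m+2, …, k, 1, 2, …, m)
kmPattern : ℕ → ℕ → List ℕ
kmPattern k m = map (λ i → m + suc i) (upTo (k ∸ m)) ++ map suc (upTo m)

f : List ℕ → ℕ → ℕ
f τ n = length (filterᵇ (λ α → avoids α p132 ∧ avoids α τ) (perms n))

-- Chebyshev polynomials of the second kind.
-- U p is written in the variable s = 2t:  U_p(t) = Σ_j w p j · (2t)^j,
-- from U_0 = 1, U_1 = 2t, U_{p+2} = 2t·U_{p+1} − U_p.
w : ℕ → ℕ → ℤ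
w zero          zero    = + 1
w zero          (suc j) = + 0
w (suc zero)    zero    = + 0
w (suc zero)    (suc zero) = + 1
w (suc zero)    (suc (suc j)) = + 0
w (suc (suc p)) zero    = - w p zero
w (suc (suc p)) (suc j) = w (suc p) j -ℤ w p (suc j)

-- V_p(x) = (√x)^p · U_p(1/(2√x)) = Σ_j w p j · x^((p−j)/2);
-- only j ≡ p (mod 2) contributes, so V_p is a polynomial in x whose
-- coefficient of x^i is  w p (p − 2i)  (for 2i ≤ p), and 0 otherwise.
V : ℕ → ℕ → ℤ
V p i = if (i + i) ≤ᵇ p then w p (p ∸ (i + i)) else + 0

-- R_p(x) = U_{p-1}(1/(2√x)) / (√x U_p(1/(2√x))) = V_{p-1}(x) / V_p(x)
-- (multiply numerator and denominator by (√x)^p); V_p(0) = 1, so this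
-- is a formal power series.  "F_τ(x) = R_p(x)" as formal power series
-- means  F_τ(x) · V_p(x) = V_{p-1}(x)  coefficientwise:

sumℤ : List ℤ → ℤ
sumℤ []       = + 0
sumℤ (x ∷ xs) = x +ℤ sumℤ xs

coeffFV : List ℕ → ℕ → ℕ → ℤ
coeffFV τ p n = sumℤ (map (λ i → (+ f τ (n ∸ i)) *ℤ V p i) (upTo (suc n)))

-- Cut a 132-avoider at its maximum n: α = X ++ n ∷ Y, where every entry of X lies above every entry
-- of Y and X, Y avoid 132.  Then α avoids 12…(j+1) iff X avoids 12…j and Y avoids 12…(j+1), and α avoids
-- [k,m] = U ++ L (U = m+1…k above L = 1…m) iff X and Y do and not (X ⊇ 12…a and Y ⊇ 12…m), a = k − m − 1.
-- So the generating functions satisfy A₀ = 0, A_{j+1} = 1 + x A_j A_{j+1} and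
-- B = 1 + x (B² − (B − A_a)(B − A_m)).  For Ch₀ = 0, Ch₁ = 1, Ch_{p+2} = Ch_{p+1} − x Ch_p (so that
-- Ch_{p+1} = V_p), induction gives A_j Ch_{j+1} = Ch_j, and with Ch_{a+b+1} = Ch_{a+1} Ch_{b+1} − x Ch_a Ch_b
-- the equation for B becomes B Ch_{k+1} = Ch_k, i.e. F_{[k,m]} = V_{k−1} / V_k = R_k.

module Submission where

open import Algebra.Bundles using (CommutativeRing)
import Algebra.Solver.Ring
import Algebra.Solver.Ring.AlmostCommutativeRing as ACR
open import Data.Bool using (Bool; true; false; _∧_; _∨_; not; if_then_else_)
open import Data.Bool.ListAction using (all; any)
open import Data.Bool.Properties
  using (T-≡; ∨-assoc; ∨-comm; ∧-assoc; ∨-idem; ∨-zeroʳ; ∨-identityʳ; ∧-comm; ∧-zeroʳ; ∧-identityʳ; ∧-conicalˡ; ∧-conicalʳ; not-injective)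
open import Data.Bool.Solver using (module ∨-∧-Solver)
open import Data.Empty using (⊥-elim)
open import Data.Integer using (ℤ; +_; -_; +-*-rawRing) renaming (_+_ to _+ℤ_; _*_ to _*ℤ_; _-_ to _-ℤ_)
import Data.Integer.Properties as ℤ
open import Data.Integer.Tactic.RingSolver using (solve-∀)
open import Data.List using (List; []; _∷_; _++_; map; concatMap; filterᵇ; length; take; drop; zip; upTo; applyUpTo)
open import Data.List.Membership.Propositional using (_∈_)
open import Data.List.Membership.Propositional.Properties using (∈-++⁺ˡ; ∈-++⁺ʳ; ∈-++⁻; ∈-map⁺; ∈-map⁻)
open import Data.List.Properties
  using ( ++-identityʳ; ++-assoc; map-∘; map-++; map-id; map-upTo; map-applyUpTo; upTo-∷ʳ; zip-map
        ; length-map; length-++; length-take; take++drop≡id; take-all; drop-all)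
open import Data.List.Relation.Unary.All using (All; []; _∷_)
import Data.List.Relation.Unary.All as All
import Data.List.Relation.Unary.All.Properties as All
open import Data.List.Relation.Unary.All.Properties using (all-upTo)
open import Data.List.Relation.Unary.AllPairs using (AllPairs; []; _∷_) renaming (map to AllPairs-map)
import Data.List.Relation.Unary.AllPairs.Properties as AllPairs
open import Data.List.Relation.Unary.Any using (here; there)
open import Data.Maybe using (Maybe; just; nothing)
open import Data.Nat using (ℕ; zero; suc; _+_; _*_; _∸_; _<_; _≤_; _<ᵇ_; _≤ᵇ_; s≤s; z≤n; z<s)
open import Data.Nat.Properties
  using ( _≟_; _≤?_; <-cmp; suc-injective; ≤-refl; ≤-reflexive; ≤-trans; ≤-antisym; ≤-pred; <-trans; <-irrefl
        ; <-≤-trans; <⇒≤; ≰⇒>; ≤⇒≯; <⇒≱; <⇒<ᵇ; <ᵇ⇒<; ≤⇒≤ᵇ; ≤ᵇ⇒≤; m<n⇒m<1+n; n<1+n; m≤n⇒m<n∨m≡n; m≤n⇒m⊓n≡m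
        ; m≤n⇒∃[o]m+o≡n; m≤m+n; m<m+n; m∸n≤m; +-monoʳ-<; +-comm; +-assoc; +-suc; +-identityʳ
        ; *-zeroʳ; *-distribˡ-+; *-distribʳ-+; +-∸-assoc; m+n∸n≡m; m∸n+n≡m; n∸n≡0)
open import Data.Nat.Tactic.RingSolver using () renaming (solve-∀ to ℕ-solve-∀)
import Data.Product as Product
open import Data.Product using (_×_; _,_; proj₁; proj₂; ∃-syntax)
open import Data.Sum using (_⊎_; inj₁; inj₂)
open import Function using (_∘_; id; case_of_)
open import Function.Bundles using (Equivalence)
open import Level using (0ℓ)
open import Relation.Binary.Definitions using (tri<; tri≈; tri>)
open import Relation.Binary.PropositionalEquality
import Relation.Binary.Reasoning.Setoid
open import Relation.Nullary using (yes; no)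

open import Defs

-- Formal power series over ℤ

Series : Set
Series = ℕ → ℤ

infix 4 _≋_
_≋_ : Series → Series → Set
F ≋ G = ∀ n → F n ≡ G n

infixl 6 _⊕_ _⊖_
infixl 7 _⊗_
infix 8 ⊝_

_⊕_ : Series → Series → Series
(F ⊕ G) n = F n +ℤ G n

⊝_ : Series → Series
(⊝ F) n = - F n

_⊖_ : Series → Series → Series
F ⊖ G = F ⊕ ⊝ G

_⊗_ : Series → Series → Series
(F ⊗ G) zero    = F 0 *ℤ G 0
(F ⊗ G) (suc n) = F 0 *ℤ G (suc n) +ℤ ((F ∘ suc) ⊗ G) n

const : ℤ → Series
const c zero    = c
const c (suc _) = + 0

-- 𝟘 and 𝟙 are constants so that they agree definitionally with the ring solver's constants.
𝟘 𝟙 𝕏 : Series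
𝟘 = const (+ 0)
𝟙 = const (+ 1)
𝕏 zero    = + 0
𝕏 (suc n) = 𝟙 n

≋-refl : ∀ {F} → F ≋ F
≋-refl _ = refl

𝟘-value : ∀ n → 𝟘 n ≡ + 0
𝟘-value zero    = refl
𝟘-value (suc n) = refl

⊗-cong : ∀ {F F′ G G′} → F ≋ F′ → G ≋ G′ → F ⊗ G ≋ F′ ⊗ G′
⊗-cong F≋ G≋ zero    = cong₂ _*ℤ_ (F≋ 0) (G≋ 0)
⊗-cong F≋ G≋ (suc n) = cong₂ _+ℤ_ (cong₂ _*ℤ_ (F≋ 0) (G≋ (suc n))) (⊗-cong (F≋ ∘ suc) G≋ n)

⊗-congˡ : ∀ F {G G′} → G ≋ G′ → F ⊗ G ≋ F ⊗ G′
⊗-congˡ F = ⊗-cong {F} ≋-refl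

⊗-congʳ : ∀ G {F F′} → F ≋ F′ → F ⊗ G ≋ F′ ⊗ G
⊗-congʳ G F≋ = ⊗-cong F≋ (≋-refl {G})

⊖-congʳ : ∀ F {G G′} → G ≋ G′ → F ⊖ G ≋ F ⊖ G′
⊖-congʳ F G≋ n = cong (λ z → F n +ℤ - z) (G≋ n)

⊖-congˡ : ∀ G {F F′} → F ≋ F′ → F ⊖ G ≋ F′ ⊖ G
⊖-congˡ G F≋ n = cong (_+ℤ - G n) (F≋ n)

⊗-zeroˡ : ∀ G → (λ _ → + 0) ⊗ G ≋ (λ _ → + 0)
⊗-zeroˡ G zero    = ℤ.*-zeroˡ (G 0)
⊗-zeroˡ G (suc n) = cong₂ _+ℤ_ (ℤ.*-zeroˡ (G (suc n))) (⊗-zeroˡ G n)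

⊗-identityˡ : ∀ G → 𝟙 ⊗ G ≋ G
⊗-identityˡ G zero    = ℤ.*-identityˡ (G 0)
⊗-identityˡ G (suc n) =
  trans (cong₂ _+ℤ_ (ℤ.*-identityˡ (G (suc n))) (⊗-zeroˡ G n)) (ℤ.+-identityʳ _)

⊗-distribʳ : ∀ F G H → (F ⊕ G) ⊗ H ≋ F ⊗ H ⊕ G ⊗ H
⊗-distribʳ F G H zero    = ℤ.*-distribʳ-+ (H 0) (F 0) (G 0)
⊗-distribʳ F G H (suc n) =
  trans (cong₂ _+ℤ_ (ℤ.*-distribʳ-+ (H (suc n)) (F 0) (G 0)) (⊗-distribʳ (F ∘ suc) (G ∘ suc) H n))
        (interchange (F 0 *ℤ H (suc n)) (G 0 *ℤ H (suc n)) _ _)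
  where
  interchange : ∀ a b c d → (a +ℤ b) +ℤ (c +ℤ d) ≡ (a +ℤ c) +ℤ (b +ℤ d)
  interchange = solve-∀

⊗-*ˡ : ∀ c F G → (λ n → c *ℤ F n) ⊗ G ≋ (λ n → c *ℤ (F ⊗ G) n)
⊗-*ˡ c F G zero    = ℤ.*-assoc c (F 0) (G 0)
⊗-*ˡ c F G (suc n) =
  trans (cong₂ _+ℤ_ (ℤ.*-assoc c (F 0) (G (suc n))) (⊗-*ˡ c (F ∘ suc) G n))
        (sym (ℤ.*-distribˡ-+ c _ _))

⊗-assoc : ∀ F G H → (F ⊗ G) ⊗ H ≋ F ⊗ (G ⊗ H)
⊗-assoc F G H zero    = ℤ.*-assoc (F 0) (G 0) (H 0)
⊗-assoc F G H (suc n) = begin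
  (F 0 *ℤ G 0) *ℤ H (suc n) +ℤ (((F ⊗ G) ∘ suc) ⊗ H) n
    ≡⟨ cong ((F 0 *ℤ G 0) *ℤ H (suc n) +ℤ_) (⊗-distribʳ (λ i → F 0 *ℤ G (suc i)) ((F ∘ suc) ⊗ G) H n) ⟩
  (F 0 *ℤ G 0) *ℤ H (suc n) +ℤ (((λ i → F 0 *ℤ G (suc i)) ⊗ H) n +ℤ (((F ∘ suc) ⊗ G) ⊗ H) n)
    ≡⟨ cong₂ (λ a b → (F 0 *ℤ G 0) *ℤ H (suc n) +ℤ (a +ℤ b)) (⊗-*ˡ (F 0) (G ∘ suc) H n) (⊗-assoc (F ∘ suc) G H n) ⟩
  (F 0 *ℤ G 0) *ℤ H (suc n) +ℤ (F 0 *ℤ ((G ∘ suc) ⊗ H) n +ℤ ((F ∘ suc) ⊗ (G ⊗ H)) n)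
    ≡⟨ regroup (F 0) (G 0) (H (suc n)) _ _ ⟩
  F 0 *ℤ (G 0 *ℤ H (suc n) +ℤ ((G ∘ suc) ⊗ H) n) +ℤ ((F ∘ suc) ⊗ (G ⊗ H)) n ∎
  where
  open ≡-Reasoning
  regroup : ∀ a b c d e → (a *ℤ b) *ℤ c +ℤ (a *ℤ d +ℤ e) ≡ a *ℤ (b *ℤ c +ℤ d) +ℤ e
  regroup = solve-∀

⊗-comm : ∀ F G → F ⊗ G ≋ G ⊗ F
⊗-comm F G zero          = ℤ.*-comm (F 0) (G 0)
⊗-comm F G (suc zero)    = swap (F 0) (G 1) (F 1) (G 0)
  where
  swap : ∀ a b c d → a *ℤ b +ℤ c *ℤ d ≡ d *ℤ c +ℤ b *ℤ a
  swap = solve-∀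
⊗-comm F G (suc (suc n)) = begin
  F 0 *ℤ G (2 + n) +ℤ ((F ∘ suc) ⊗ G) (suc n)
    ≡⟨ cong (F 0 *ℤ G (2 + n) +ℤ_) (⊗-comm (F ∘ suc) G (suc n)) ⟩
  F 0 *ℤ G (2 + n) +ℤ (G 0 *ℤ F (2 + n) +ℤ ((G ∘ suc) ⊗ (F ∘ suc)) n)
    ≡⟨ cong (λ z → F 0 *ℤ G (2 + n) +ℤ (G 0 *ℤ F (2 + n) +ℤ z)) (⊗-comm (G ∘ suc) (F ∘ suc) n) ⟩
  F 0 *ℤ G (2 + n) +ℤ (G 0 *ℤ F (2 + n) +ℤ ((F ∘ suc) ⊗ (G ∘ suc)) n)
    ≡⟨ swap (F 0 *ℤ G (2 + n)) (G 0 *ℤ F (2 + n)) _ ⟩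
  G 0 *ℤ F (2 + n) +ℤ (F 0 *ℤ G (2 + n) +ℤ ((F ∘ suc) ⊗ (G ∘ suc)) n)
    ≡⟨ cong (G 0 *ℤ F (2 + n) +ℤ_) (⊗-comm F (G ∘ suc) (suc n)) ⟩
  G 0 *ℤ F (2 + n) +ℤ ((G ∘ suc) ⊗ F) (suc n) ∎
  where
  open ≡-Reasoning
  swap : ∀ a b c → a +ℤ (b +ℤ c) ≡ b +ℤ (a +ℤ c)
  swap = solve-∀

seriesRing : CommutativeRing 0ℓ 0ℓ
seriesRing = record
  { Carrier = Series
  ; _≈_ = _≋_
  ; _+_ = _⊕_
  ; _*_ = _⊗_
  ; -_ = ⊝_
  ; 0# = 𝟘
  ; 1# = 𝟙
  ; isCommutativeRing = record
    { isRing = record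
      { +-isAbelianGroup = record
        { isGroup = record
          { isMonoid = record
            { isSemigroup = record
              { isMagma = record
                { isEquivalence = record
                  { refl = ≋-refl ; sym = λ p n → sym (p n) ; trans = λ p q n → trans (p n) (q n) }
                ; ∙-cong = λ p q n → cong₂ _+ℤ_ (p n) (q n) }
              ; assoc = λ F G H n → ℤ.+-assoc (F n) (G n) (H n) }
            ; identity = (λ F n → trans (cong (_+ℤ F n) (𝟘-value n)) (ℤ.+-identityˡ (F n)))
                       , (λ F n → trans (cong (F n +ℤ_) (𝟘-value n)) (ℤ.+-identityʳ (F n))) }
          ; inverse = (λ F n → trans (ℤ.+-inverseˡ (F n)) (sym (𝟘-value n)))
                    , (λ F n → trans (ℤ.+-inverseʳ (F n)) (sym (𝟘-value n)))
          ; ⁻¹-cong = λ p n → cong -_ (p n) }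
        ; comm = λ F G n → ℤ.+-comm (F n) (G n) }
      ; *-cong = ⊗-cong
      ; *-assoc = ⊗-assoc
      ; *-identity = ⊗-identityˡ , (λ F n → trans (⊗-comm F 𝟙 n) (⊗-identityˡ F n))
      ; distrib = (λ F G H n → trans (⊗-comm F (G ⊕ H) n)
                                 (trans (⊗-distribʳ G H F n) (cong₂ _+ℤ_ (⊗-comm G F n) (⊗-comm H F n))))
                , (λ H F G → ⊗-distribʳ F G H) }
    ; *-comm = ⊗-comm } }

const-* : ∀ a b → const (a *ℤ b) ≋ const a ⊗ const b
const-* a b zero    = refl
const-* a b (suc n) = sym (cong₂ _+ℤ_ (ℤ.*-zeroʳ a) (⊗-zeroˡ (const b) n))

const-morphism : ACR._-Raw-AlmostCommutative⟶_ +-*-rawRing (ACR.fromCommutativeRing seriesRing)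
const-morphism = record
  { ⟦_⟧    = const
  ; +-homo = λ a b → λ { zero → refl ; (suc n) → refl }
  ; *-homo = const-*
  ; -‿homo = λ a → λ { zero → refl ; (suc n) → refl }
  ; 0-homo = λ { zero → refl ; (suc n) → refl }
  ; 1-homo = λ { zero → refl ; (suc n) → refl } }

const-≟ : ∀ a b → Maybe (const a ≋ const b)
const-≟ a b with a ℤ.≟ b
... | yes refl = just (λ _ → refl)
... | no _     = nothing

module ≋-Solver = Algebra.Solver.Ring +-*-rawRing (ACR.fromCommutativeRing seriesRing) const-morphism const-≟

open CommutativeRing seriesRing
  using (zeroˡ; *-identityˡ)
  renaming (setoid to ≋-setoid; sym to ≋-sym; trans to ≋-trans)
module ≋-Reasoning = Relation.Binary.Reasoning.Setoid ≋-setoid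

shift : Series → Series
shift F zero    = + 0
shift F (suc n) = F n

𝕏⊗≋shift : ∀ F → 𝕏 ⊗ F ≋ shift F
𝕏⊗≋shift F zero    = refl
𝕏⊗≋shift F (suc n) = trans (ℤ.+-identityˡ _) (⊗-identityˡ F n)

⊖𝕏⊗≋𝟙 : ∀ G H → G 0 ≡ + 1 → (∀ n → G (suc n) ≡ H n) → G ⊖ 𝕏 ⊗ H ≋ 𝟙
⊖𝕏⊗≋𝟙 G H G₀ G₊ zero    = begin
  G 0 +ℤ - (𝕏 ⊗ H) 0 ≡⟨ cong₂ (λ a b → a +ℤ - b) G₀ (𝕏⊗≋shift H 0) ⟩
  + 1 +ℤ - + 0       ≡⟨⟩
  + 1                ∎
  where open ≡-Reasoning
⊖𝕏⊗≋𝟙 G H G₀ G₊ (suc n) = begin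
  G (suc n) +ℤ - (𝕏 ⊗ H) (suc n) ≡⟨ cong₂ (λ a b → a +ℤ - b) (G₊ n) (𝕏⊗≋shift H (suc n)) ⟩
  H n +ℤ - H n                   ≡⟨ ℤ.+-inverseʳ (H n) ⟩
  + 0                            ∎
  where open ≡-Reasoning

-- Chebyshev-type series

-- Ch (suc p) is the series of V p (Ch 0 = 0 plays the role of V₋₁).
Ch : ℕ → Series
Ch zero          = 𝟘
Ch (suc zero)    = 𝟙
Ch (suc (suc p)) = Ch (suc p) ⊖ 𝕏 ⊗ Ch p

Ch-+ : ∀ a b → Ch (suc (a + b)) ≋ Ch (suc a) ⊗ Ch (suc b) ⊖ 𝕏 ⊗ Ch a ⊗ Ch b
Ch-+ zero    b = solve 3 (λ P p x → P := con (+ 1) :* P :- x :* con (+ 0) :* p) ≋-refl (Ch (suc b)) (Ch b) 𝕏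
  where open ≋-Solver
Ch-+ (suc a) b = begin
  Ch (2 + (a + b))
    ≡⟨ cong (λ c → Ch (suc c)) (sym (+-suc a b)) ⟩
  Ch (suc (a + suc b))
    ≈⟨ Ch-+ a (suc b) ⟩
  Ch (suc a) ⊗ (Ch (suc b) ⊖ 𝕏 ⊗ Ch b) ⊖ 𝕏 ⊗ Ch a ⊗ Ch (suc b)
    ≈⟨ solve 5 (λ P p Q q x → P :* (Q :- x :* q) :- x :* p :* Q := (P :- x :* p) :* Q :- x :* P :* q)
             ≋-refl (Ch (suc a)) (Ch a) (Ch (suc b)) (Ch b) 𝕏 ⟩
  (Ch (suc a) ⊖ 𝕏 ⊗ Ch a) ⊗ Ch (suc b) ⊖ 𝕏 ⊗ Ch (suc a) ⊗ Ch b ∎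
  where
  open ≋-Reasoning
  open ≋-Solver

increasing-ratio : (A : ℕ → Series) → A 0 ≋ 𝟘 →
                   (∀ j → A (suc j) ⊖ 𝕏 ⊗ (A j ⊗ A (suc j)) ≋ 𝟙) →
                   ∀ j → A j ⊗ Ch (suc j) ≋ Ch j
increasing-ratio A A₀ A₊ zero    = ≋-trans (⊗-congʳ 𝟙 A₀) (zeroˡ 𝟙)
increasing-ratio A A₀ A₊ (suc j) = begin
  A (suc j) ⊗ (Ch (suc j) ⊖ 𝕏 ⊗ Ch j)
    ≈⟨ ⊗-congˡ (A (suc j)) (⊖-congʳ (Ch (suc j)) (⊗-congˡ 𝕏 (≋-sym (increasing-ratio A A₀ A₊ j)))) ⟩
  A (suc j) ⊗ (Ch (suc j) ⊖ 𝕏 ⊗ (A j ⊗ Ch (suc j)))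
    ≈⟨ solve 4 (λ A′ A P x → A′ :* (P :- x :* (A :* P)) := (A′ :- x :* (A :* A′)) :* P)
             ≋-refl (A (suc j)) (A j) (Ch (suc j)) 𝕏 ⟩
  (A (suc j) ⊖ 𝕏 ⊗ (A j ⊗ A (suc j))) ⊗ Ch (suc j)
    ≈⟨ ⊗-congʳ (Ch (suc j)) (A₊ j) ⟩
  𝟙 ⊗ Ch (suc j)
    ≈⟨ *-identityˡ (Ch (suc j)) ⟩
  Ch (suc j) ∎
  where
  open ≋-Reasoning
  open ≋-Solver

km-ratio : ∀ {B Aa Ab} a b → Aa ⊗ Ch (suc a) ≋ Ch a → Ab ⊗ Ch (suc b) ≋ Ch b →
           B ⊖ 𝕏 ⊗ (B ⊗ B ⊖ (B ⊖ Aa) ⊗ (B ⊖ Ab)) ≋ 𝟙 →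
           B ⊗ Ch (2 + (a + b)) ≋ Ch (suc (a + b))
km-ratio {B} {Aa} {Ab} a b Aa-ratio Ab-ratio B-rec = begin
  B ⊗ Ch (2 + (a + b))
    ≈⟨ ⊗-congˡ B (Ch-+ (suc a) b) ⟩
  B ⊗ ((P ⊖ 𝕏 ⊗ p) ⊗ Q ⊖ 𝕏 ⊗ P ⊗ q)
    ≈⟨ ⊗-congˡ B (≋-trans (⊖-congˡ (𝕏 ⊗ P ⊗ q) (⊗-congʳ Q (⊖-congʳ P (⊗-congˡ 𝕏 (≋-sym Aa-ratio)))))
                           (⊖-congʳ ((P ⊖ 𝕏 ⊗ (Aa ⊗ P)) ⊗ Q) (⊗-congˡ (𝕏 ⊗ P) (≋-sym Ab-ratio)))) ⟩
  B ⊗ ((P ⊖ 𝕏 ⊗ (Aa ⊗ P)) ⊗ Q ⊖ 𝕏 ⊗ P ⊗ (Ab ⊗ Q))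
    ≈⟨ solve 6 (λ B Aa Ab P Q x →
                  B :* ((P :- x :* (Aa :* P)) :* Q :- x :* P :* (Ab :* Q))
               := (B :- x :* (B :* B :- (B :- Aa) :* (B :- Ab))) :* P :* Q :- x :* (Aa :* P) :* (Ab :* Q))
             ≋-refl B Aa Ab P Q 𝕏 ⟩
  (B ⊖ 𝕏 ⊗ (B ⊗ B ⊖ (B ⊖ Aa) ⊗ (B ⊖ Ab))) ⊗ P ⊗ Q ⊖ 𝕏 ⊗ (Aa ⊗ P) ⊗ (Ab ⊗ Q)
    ≈⟨ ≋-trans (⊖-congˡ (𝕏 ⊗ (Aa ⊗ P) ⊗ (Ab ⊗ Q)) (⊗-congʳ Q (⊗-congʳ P B-rec)))
               (⊖-congʳ (𝟙 ⊗ P ⊗ Q) (⊗-cong (⊗-congˡ 𝕏 Aa-ratio) Ab-ratio)) ⟩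
  𝟙 ⊗ P ⊗ Q ⊖ 𝕏 ⊗ p ⊗ q
    ≈⟨ ⊖-congˡ (𝕏 ⊗ p ⊗ q) (⊗-congʳ Q (*-identityˡ P)) ⟩
  P ⊗ Q ⊖ 𝕏 ⊗ p ⊗ q
    ≈⟨ ≋-sym (Ch-+ a b) ⟩
  Ch (suc (a + b)) ∎
  where
  open ≋-Reasoning
  open ≋-Solver
  P p Q q : Series
  P = Ch (suc a)
  p = Ch a
  Q = Ch (suc b)
  q = Ch b

<ᵇ-true : ∀ {m n} → m < n → (m <ᵇ n) ≡ true
<ᵇ-true m<n = Equivalence.to T-≡ (<⇒<ᵇ m<n)

<ᵇ-false : ∀ {m n} → n ≤ m → (m <ᵇ n) ≡ false
<ᵇ-false {m} {n} n≤m with m <ᵇ n in eq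
... | false = refl
... | true  = ⊥-elim (≤⇒≯ n≤m (<ᵇ⇒< m n (Equivalence.from T-≡ eq)))

≤ᵇ-true : ∀ {m n} → m ≤ n → (m ≤ᵇ n) ≡ true
≤ᵇ-true m≤n = Equivalence.to T-≡ (≤⇒≤ᵇ m≤n)

≤ᵇ-false : ∀ {m n} → n < m → (m ≤ᵇ n) ≡ false
≤ᵇ-false {m} {n} n<m with m ≤ᵇ n in eq
... | false = refl
... | true  = ⊥-elim (<⇒≱ n<m (≤ᵇ⇒≤ m n (Equivalence.from T-≡ eq)))

≡⇒==ℕ : ∀ {a b} → a ≡ b → (a ==ℕ b) ≡ true
≡⇒==ℕ {a} refl rewrite ≤ᵇ-true (≤-refl {a}) = refl

==ℕ⇒≡ : ∀ a b → (a ==ℕ b) ≡ true → a ≡ b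
==ℕ⇒≡ a b a==b = ≤-antisym (≤ᵇ⇒≤ a b (Equivalence.from T-≡ (∧-conicalˡ (a ≤ᵇ b) (b ≤ᵇ a) a==b)))
                           (≤ᵇ⇒≤ b a (Equivalence.from T-≡ (∧-conicalʳ (a ≤ᵇ b) (b ≤ᵇ a) a==b)))

≢⇒==ℕ-false : ∀ {a b} → a ≢ b → (a ==ℕ b) ≡ false
≢⇒==ℕ-false {a} {b} a≢b with a ==ℕ b in eq
... | false = refl
... | true  = ⊥-elim (a≢b (==ℕ⇒≡ a b eq))

==ℕ-+ˡ : ∀ a b c → ((a + b) ==ℕ (a + c)) ≡ (b ==ℕ c)
==ℕ-+ˡ zero    b c = refl
==ℕ-+ˡ (suc a) b c = trans (cong₂ _∧_ (≤ᵇ-suc (a + b) (a + c)) (≤ᵇ-suc (a + c) (a + b))) (==ℕ-+ˡ a b c)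
  where
  ≤ᵇ-suc : ∀ m n → (suc m ≤ᵇ suc n) ≡ (m ≤ᵇ n)
  ≤ᵇ-suc zero    n = refl
  ≤ᵇ-suc (suc m) n = refl

==ᵇ-refl : ∀ a → (a ==ᵇ a) ≡ true
==ᵇ-refl true  = refl
==ᵇ-refl false = refl

∧-interchange : ∀ a b c d → (a ∧ b) ∧ (c ∧ d) ≡ (a ∧ c) ∧ (b ∧ d)
∧-interchange a b c d = solve 4 (λ a b c d → (a :* b) :* (c :* d) := (a :* c) :* (b :* d)) refl a b c d
  where open ∨-∧-Solver

w-above : ∀ p j → p < j → w p j ≡ + 0
w-above zero          (suc j)       _               = refl
w-above (suc zero)    (suc zero)    (s≤s ())
w-above (suc zero)    (suc (suc j)) _               = refl
w-above (suc (suc p)) (suc j)       (s≤s p+1<j)     =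
  cong₂ _-ℤ_ (w-above (suc p) j p+1<j) (w-above p (suc j) (<⇒≤ (m<n⇒m<1+n p+1<j)))

-- V p i = Vₜ p (i + i); the recurrence is easier to state for an arbitrary degree t.
Vₜ : ℕ → ℕ → ℤ
Vₜ p t = if t ≤ᵇ p then w p (p ∸ t) else + 0

Vₜ-rec : ∀ p t → Vₜ (2 + p) (2 + t) ≡ Vₜ (suc p) (2 + t) -ℤ Vₜ p t
Vₜ-rec p t with <-cmp t p
... | tri< t<p _ _ rewrite <ᵇ-true (m<n⇒m<1+n t<p) | <ᵇ-true t<p | ≤ᵇ-true (<⇒≤ t<p) | +-∸-assoc 1 t<p = refl
... | tri≈ _ refl _ rewrite <ᵇ-true (n<1+n t) | <ᵇ-false {t} {t} ≤-refl | ≤ᵇ-true (≤-refl {t}) | n∸n≡0 t = sym (ℤ.+-identityˡ _)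
... | tri> _ _ p<t rewrite <ᵇ-false {t} {suc p} p<t | <ᵇ-false {t} {p} (<⇒≤ p<t) | ≤ᵇ-false p<t = refl

V≡Vₜ : ∀ p i → V p (suc i) ≡ Vₜ p (2 + (i + i))
V≡Vₜ p i = cong (λ t → Vₜ p (suc t)) (+-suc i i)

V-rec : ∀ p i → V (2 + p) (suc i) ≡ V (suc p) (suc i) -ℤ V p i
V-rec p i = begin
  V (2 + p) (suc i)                       ≡⟨ V≡Vₜ (2 + p) i ⟩
  Vₜ (2 + p) (2 + (i + i))                ≡⟨ Vₜ-rec p (i + i) ⟩
  Vₜ (suc p) (2 + (i + i)) -ℤ V p i       ≡⟨ cong (_-ℤ V p i) (V≡Vₜ (suc p) i) ⟨
  V (suc p) (suc i) -ℤ V p i              ∎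
  where open ≡-Reasoning

Ch-suc≋V : ∀ p → Ch (suc p) ≋ V p
Ch-suc≋V zero          zero    = refl
Ch-suc≋V zero          (suc i) = refl
Ch-suc≋V (suc zero)    zero    = refl
Ch-suc≋V (suc zero)    (suc i) = begin
  + 0 -ℤ (𝕏 ⊗ 𝟘) (suc i)  ≡⟨ cong (λ z → + 0 -ℤ z) (𝕏⊗≋shift 𝟘 (suc i)) ⟩
  + 0 -ℤ 𝟘 i              ≡⟨ cong (λ z → + 0 -ℤ z) (𝟘-value i) ⟩
  + 0                     ≡⟨ cong (λ b → if b then w 1 (1 ∸ (2 + (i + i))) else + 0) (≤ᵇ-false {2 + (i + i)} {1} (s≤s z<s)) ⟨
  Vₜ 1 (2 + (i + i))      ≡⟨ V≡Vₜ 1 i ⟨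
  V 1 (suc i)             ∎
  where open ≡-Reasoning
Ch-suc≋V (suc (suc p)) zero    = begin
  Ch (2 + p) 0 -ℤ (𝕏 ⊗ Ch (suc p)) 0  ≡⟨ cong₂ _-ℤ_ (Ch-suc≋V (suc p) 0) (𝕏⊗≋shift (Ch (suc p)) 0) ⟩
  w (suc p) (suc p) -ℤ + 0           ≡⟨ cong (w (suc p) (suc p) -ℤ_) (w-above p (2 + p) (m<n⇒m<1+n (n<1+n p))) ⟨
  w (suc p) (suc p) -ℤ w p (2 + p)   ∎
  where open ≡-Reasoning
Ch-suc≋V (suc (suc p)) (suc i) = begin
  Ch (2 + p) (suc i) -ℤ (𝕏 ⊗ Ch (suc p)) (suc i)
    ≡⟨ cong₂ _-ℤ_ (Ch-suc≋V (suc p) (suc i)) (𝕏⊗≋shift (Ch (suc p)) (suc i)) ⟩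
  V (suc p) (suc i) -ℤ Ch (suc p) i
    ≡⟨ cong (V (suc p) (suc i) -ℤ_) (Ch-suc≋V p i) ⟩
  V (suc p) (suc i) -ℤ V p i
    ≡⟨ V-rec p i ⟨
  V (2 + p) (suc i) ∎
  where open ≡-Reasoning

module _ {A : Set} where

  any-++ : ∀ (h : A → Bool) xs ys → any h (xs ++ ys) ≡ any h xs ∨ any h ys
  any-++ h []       ys = refl
  any-++ h (x ∷ xs) ys = trans (cong (h x ∨_) (any-++ h xs ys)) (sym (∨-assoc (h x) _ _))

  all-++ : ∀ (h : A → Bool) xs ys → all h (xs ++ ys) ≡ all h xs ∧ all h ys
  all-++ h []       ys = refl
  all-++ h (x ∷ xs) ys = trans (cong (h x ∧_) (all-++ h xs ys)) (sym (∧-assoc (h x) _ _))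

  any-cong : ∀ {h k : A → Bool} xs → (∀ {x} → x ∈ xs → h x ≡ k x) → any h xs ≡ any k xs
  any-cong []       h≡k = refl
  any-cong (x ∷ xs) h≡k = cong₂ _∨_ (h≡k (here refl)) (any-cong xs (h≡k ∘ there))

  all-cong : ∀ {h k : A → Bool} xs → (∀ {x} → x ∈ xs → h x ≡ k x) → all h xs ≡ all k xs
  all-cong []       h≡k = refl
  all-cong (x ∷ xs) h≡k = cong₂ _∧_ (h≡k (here refl)) (all-cong xs (h≡k ∘ there))

  any-∨ : ∀ (h k : A → Bool) xs → any (λ x → h x ∨ k x) xs ≡ any h xs ∨ any k xs
  any-∨ h k []       = refl
  any-∨ h k (x ∷ xs) = trans (cong ((h x ∨ k x) ∨_) (any-∨ h k xs)) (∨-interchange (h x) (k x) _ _)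
    where
    ∨-interchange : ∀ a b c d → (a ∨ b) ∨ (c ∨ d) ≡ (a ∨ c) ∨ (b ∨ d)
    ∨-interchange a b c d = solve 4 (λ a b c d → (a :+ b) :+ (c :+ d) := (a :+ c) :+ (b :+ d)) refl a b c d
      where open ∨-∧-Solver

  all-∧ : ∀ (h k : A → Bool) xs → all (λ x → h x ∧ k x) xs ≡ all h xs ∧ all k xs
  all-∧ h k []       = refl
  all-∧ h k (x ∷ xs) = trans (cong ((h x ∧ k x) ∧_) (all-∧ h k xs)) (∧-interchange (h x) (k x) _ _)

  any-∧ˡ : ∀ b (h : A → Bool) xs → any (λ x → b ∧ h x) xs ≡ b ∧ any h xs
  any-∧ˡ true  h xs       = refl
  any-∧ˡ false h []       = refl
  any-∧ˡ false h (x ∷ xs) = any-∧ˡ false h xs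

  any-∧ʳ : ∀ b (h : A → Bool) xs → any (λ x → h x ∧ b) xs ≡ any h xs ∧ b
  any-∧ʳ b h xs = trans (any-cong xs (λ {x} _ → ∧-comm (h x) b)) (trans (any-∧ˡ b h xs) (∧-comm b _))

  any-true⁺ : ∀ (h : A → Bool) {x} xs → x ∈ xs → h x ≡ true → any h xs ≡ true
  any-true⁺ h (y ∷ xs) (here refl) hx = cong (_∨ any h xs) hx
  any-true⁺ h (y ∷ xs) (there x∈)  hx = trans (cong (h y ∨_) (any-true⁺ h xs x∈ hx)) (∨-zeroʳ (h y))

  any-true⁻ : ∀ (h : A → Bool) xs → any h xs ≡ true → ∃[ x ] (x ∈ xs × h x ≡ true)
  any-true⁻ h (x ∷ xs) any≡ with h x in hx
  ... | true  = x , here refl , hx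
  ... | false = let (y , y∈ , hy) = any-true⁻ h xs any≡ in y , there y∈ , hy

  all-true⁺ : ∀ (h : A → Bool) xs → (∀ {x} → x ∈ xs → h x ≡ true) → all h xs ≡ true
  all-true⁺ h []       _  = refl
  all-true⁺ h (x ∷ xs) hx = trans (cong (_∧ all h xs) (hx (here refl))) (all-true⁺ h xs (hx ∘ there))

  all-false⁻ : ∀ (h : A → Bool) xs → all h xs ≡ false → ∃[ x ] (x ∈ xs × h x ≡ false)
  all-false⁻ h (x ∷ xs) all≡ with h x in hx
  ... | false = x , here refl , hx
  ... | true  = let (y , y∈ , hy) = all-false⁻ h xs all≡ in y , there y∈ , hy

  all-false⁺ : ∀ (h : A → Bool) {x} xs → x ∈ xs → h x ≡ false → all h xs ≡ false
  all-false⁺ h (y ∷ xs) (here refl) hx = cong (_∧ all h xs) hx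
  all-false⁺ h (y ∷ xs) (there x∈)  hx = trans (cong (h y ∧_) (all-false⁺ h xs x∈ hx)) (∧-zeroʳ (h y))

module _ {A B : Set} where

  any-map : ∀ (h : B → Bool) (g : A → B) xs → any h (map g xs) ≡ any (h ∘ g) xs
  any-map h g []       = refl
  any-map h g (x ∷ xs) = cong (h (g x) ∨_) (any-map h g xs)

  all-map : ∀ (h : B → Bool) (g : A → B) xs → all h (map g xs) ≡ all (h ∘ g) xs
  all-map h g []       = refl
  all-map h g (x ∷ xs) = cong (h (g x) ∧_) (all-map h g xs)

module _ {A : Set} where

  ∷∈subseqs : ∀ {s} x (xs : List A) → s ∈ subseqs xs → x ∷ s ∈ subseqs (x ∷ xs)
  ∷∈subseqs x xs s∈ = ∈-++⁺ˡ (∈-map⁺ (x ∷_) s∈)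

  ∈subseqs-∷ : ∀ {s} x (xs : List A) → s ∈ subseqs xs → s ∈ subseqs (x ∷ xs)
  ∈subseqs-∷ x xs s∈ = ∈-++⁺ʳ (map (x ∷_) (subseqs xs)) s∈

  ∈subseqs-∷⁻ : ∀ {s} x (xs : List A) → s ∈ subseqs (x ∷ xs) →
                (∃[ s′ ] (s ≡ x ∷ s′ × s′ ∈ subseqs xs)) ⊎ s ∈ subseqs xs
  ∈subseqs-∷⁻ x xs s∈ with ∈-++⁻ (map (x ∷_) (subseqs xs)) s∈
  ... | inj₁ s∈∷ = let (s′ , s′∈ , s≡) = ∈-map⁻ (x ∷_) s∈∷ in inj₁ (s′ , s≡ , s′∈)
  ... | inj₂ s∈′ = inj₂ s∈′

  []∈subseqs : ∀ (xs : List A) → [] ∈ subseqs xs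
  []∈subseqs []       = here refl
  []∈subseqs (x ∷ xs) = ∈subseqs-∷ x xs ([]∈subseqs xs)

  [-]∈subseqs : ∀ {x} (xs : List A) → x ∈ xs → x ∷ [] ∈ subseqs xs
  [-]∈subseqs (y ∷ xs) (here refl) = ∷∈subseqs y xs ([]∈subseqs xs)
  [-]∈subseqs (y ∷ xs) (there x∈) = ∈subseqs-∷ y xs ([-]∈subseqs xs x∈)

  ++∈subseqs : ∀ {s t} (xs ys : List A) → s ∈ subseqs xs → t ∈ subseqs ys → s ++ t ∈ subseqs (xs ++ ys)
  ++∈subseqs []       ys (here refl) t∈ = t∈
  ++∈subseqs (x ∷ xs) ys s∈ t∈ with ∈subseqs-∷⁻ x xs s∈
  ... | inj₁ (s′ , refl , s′∈) = ∷∈subseqs x (xs ++ ys) (++∈subseqs xs ys s′∈ t∈)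
  ... | inj₂ s∈′              = ∈subseqs-∷ x (xs ++ ys) (++∈subseqs xs ys s∈′ t∈)

  ∈subseqs⇒⊆ : ∀ {s y} (xs : List A) → s ∈ subseqs xs → y ∈ s → y ∈ xs
  ∈subseqs⇒⊆ []       (here refl) ()
  ∈subseqs⇒⊆ (x ∷ xs) s∈ y∈ with ∈subseqs-∷⁻ x xs s∈
  ∈subseqs⇒⊆ (x ∷ xs) s∈ (here refl) | inj₁ (s′ , refl , s′∈) = here refl
  ∈subseqs⇒⊆ (x ∷ xs) s∈ (there y∈)  | inj₁ (s′ , refl , s′∈) = there (∈subseqs⇒⊆ xs s′∈ y∈)
  ∈subseqs⇒⊆ (x ∷ xs) s∈ y∈          | inj₂ s∈′              = there (∈subseqs⇒⊆ xs s∈′ y∈)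

  take∈subseqs : ∀ {s} j (xs : List A) → s ∈ subseqs xs → take j s ∈ subseqs xs
  take∈subseqs zero    xs       s∈          = []∈subseqs xs
  take∈subseqs (suc j) []       (here refl) = here refl
  take∈subseqs (suc j) (x ∷ xs) s∈ with ∈subseqs-∷⁻ x xs s∈
  ... | inj₁ (s′ , refl , s′∈) = ∷∈subseqs x xs (take∈subseqs j xs s′∈)
  ... | inj₂ s∈′              = ∈subseqs-∷ x xs (take∈subseqs (suc j) xs s∈′)

  drop∈subseqs : ∀ {s} j (xs : List A) → s ∈ subseqs xs → drop j s ∈ subseqs xs
  drop∈subseqs zero    xs       s∈          = s∈
  drop∈subseqs (suc j) []       (here refl) = here refl
  drop∈subseqs (suc j) (x ∷ xs) s∈ with ∈subseqs-∷⁻ x xs s∈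
  ... | inj₁ (s′ , refl , s′∈) = ∈subseqs-∷ x xs (drop∈subseqs j xs s′∈)
  ... | inj₂ s∈′              = ∈subseqs-∷ x xs (drop∈subseqs (suc j) xs s∈′)

  any-subseqs-++ : ∀ (h : List A → Bool) xs ys →
    any h (subseqs (xs ++ ys)) ≡ any (λ s → any (λ t → h (s ++ t)) (subseqs ys)) (subseqs xs)
  any-subseqs-++ h []       ys = sym (∨-identityʳ _)
  any-subseqs-++ h (x ∷ xs) ys = begin
    any h (map (x ∷_) (subseqs (xs ++ ys)) ++ subseqs (xs ++ ys))
      ≡⟨ any-++ h (map (x ∷_) (subseqs (xs ++ ys))) (subseqs (xs ++ ys)) ⟩
    any h (map (x ∷_) (subseqs (xs ++ ys))) ∨ any h (subseqs (xs ++ ys))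
      ≡⟨ cong₂ _∨_ (trans (any-map h (x ∷_) (subseqs (xs ++ ys))) (any-subseqs-++ (h ∘ (x ∷_)) xs ys))
                   (any-subseqs-++ h xs ys) ⟩
    any (g ∘ (x ∷_)) (subseqs xs) ∨ any g (subseqs xs)
      ≡⟨ cong (_∨ any g (subseqs xs)) (any-map g (x ∷_) (subseqs xs)) ⟨
    any g (map (x ∷_) (subseqs xs)) ∨ any g (subseqs xs)
      ≡⟨ any-++ g (map (x ∷_) (subseqs xs)) (subseqs xs) ⟨
    any g (map (x ∷_) (subseqs xs) ++ subseqs xs) ∎
    where
    open ≡-Reasoning
    g : List A → Bool
    g s = any (λ t → h (s ++ t)) (subseqs ys)

module _ {A B : Set} where

  subseqs-map : ∀ (g : A → B) xs → subseqs (map g xs) ≡ map (map g) (subseqs xs)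
  subseqs-map g []       = refl
  subseqs-map g (x ∷ xs) = begin
    map (g x ∷_) (subseqs (map g xs)) ++ subseqs (map g xs)
      ≡⟨ cong (λ ss → map (g x ∷_) ss ++ ss) (subseqs-map g xs) ⟩
    map (g x ∷_) (map (map g) (subseqs xs)) ++ map (map g) (subseqs xs)
      ≡⟨ cong (_++ map (map g) (subseqs xs)) (trans (sym (map-∘ (subseqs xs))) (map-∘ (subseqs xs))) ⟩
    map (map g) (map (x ∷_) (subseqs xs)) ++ map (map g) (subseqs xs)
      ≡⟨ map-++ (map g) (map (x ∷_) (subseqs xs)) (subseqs xs) ⟨
    map (map g) (map (x ∷_) (subseqs xs) ++ subseqs xs) ∎
    where open ≡-Reasoning

sameOrder : ℕ × ℕ → ℕ × ℕ → Bool
sameOrder p q = (proj₁ p <ᵇ proj₁ q) ==ᵇ (proj₂ p <ᵇ proj₂ q)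

allSameOrder : List (ℕ × ℕ) → List (ℕ × ℕ) → Bool
allSameOrder ps qs = all (λ p → all (sameOrder p) qs) ps

allSameOrder-++ : ∀ ps₁ ps₂ → allSameOrder (ps₁ ++ ps₂) (ps₁ ++ ps₂) ≡
  (allSameOrder ps₁ ps₂ ∧ allSameOrder ps₂ ps₁) ∧ (allSameOrder ps₁ ps₁ ∧ allSameOrder ps₂ ps₂)
allSameOrder-++ ps₁ ps₂ = begin
  all (λ p → all (sameOrder p) (ps₁ ++ ps₂)) (ps₁ ++ ps₂)
    ≡⟨ all-++ _ ps₁ ps₂ ⟩
  all (λ p → all (sameOrder p) (ps₁ ++ ps₂)) ps₁ ∧ all (λ p → all (sameOrder p) (ps₁ ++ ps₂)) ps₂
    ≡⟨ cong₂ _∧_ (split ps₁) (split ps₂) ⟩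
  (allSameOrder ps₁ ps₁ ∧ allSameOrder ps₁ ps₂) ∧ (allSameOrder ps₂ ps₁ ∧ allSameOrder ps₂ ps₂)
    ≡⟨ regroup (allSameOrder ps₁ ps₁) (allSameOrder ps₁ ps₂) (allSameOrder ps₂ ps₁) (allSameOrder ps₂ ps₂) ⟩
  (allSameOrder ps₁ ps₂ ∧ allSameOrder ps₂ ps₁) ∧ (allSameOrder ps₁ ps₁ ∧ allSameOrder ps₂ ps₂) ∎
  where
  open ≡-Reasoning
  split : ∀ ps → all (λ p → all (sameOrder p) (ps₁ ++ ps₂)) ps ≡ allSameOrder ps ps₁ ∧ allSameOrder ps ps₂
  split ps = trans (all-cong ps (λ {p} _ → all-++ (sameOrder p) ps₁ ps₂)) (all-∧ _ _ ps)
  regroup : ∀ a b c d → (a ∧ b) ∧ (c ∧ d) ≡ (b ∧ c) ∧ (a ∧ d)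
  regroup a b c d = solve 4 (λ a b c d → (a :* b) :* (c :* d) := (b :* c) :* (a :* d)) refl a b c d
    where open ∨-∧-Solver

zip-++ : ∀ {A B : Set} (s₁ s₂ : List A) (t₁ t₂ : List B) → length s₁ ≡ length t₁ →
         zip (s₁ ++ s₂) (t₁ ++ t₂) ≡ zip s₁ t₁ ++ zip s₂ t₂
zip-++ []       s₂ []       t₂ _ = refl
zip-++ (x ∷ s₁) s₂ (y ∷ t₁) t₂ e = cong ((x , y) ∷_) (zip-++ s₁ s₂ t₁ t₂ (suc-injective e))

length-++-==ℕ : ∀ {A B : Set} (s₁ s₂ : List A) (t₁ t₂ : List B) → length s₁ ≡ length t₁ →
                (length (s₁ ++ s₂) ==ℕ length (t₁ ++ t₂)) ≡ (length s₂ ==ℕ length t₂)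
length-++-==ℕ s₁ s₂ t₁ t₂ e = begin
  length (s₁ ++ s₂) ==ℕ length (t₁ ++ t₂)             ≡⟨ cong₂ _==ℕ_ (length-++ s₁) (length-++ t₁) ⟩
  (length s₁ + length s₂) ==ℕ (length t₁ + length t₂) ≡⟨ cong (λ l → (l + length s₂) ==ℕ (length t₁ + length t₂)) e ⟩
  (length t₁ + length s₂) ==ℕ (length t₁ + length t₂) ≡⟨ ==ℕ-+ˡ (length t₁) _ _ ⟩
  length s₂ ==ℕ length t₂                             ∎
  where open ≡-Reasoning

orderIso≡allSameOrder : ∀ (s t : List ℕ) → length s ≡ length t → orderIso s t ≡ allSameOrder (zip s t) (zip s t)
orderIso≡allSameOrder s t e = cong (_∧ allSameOrder (zip s t) (zip s t)) (≡⇒==ℕ e)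

orderIso-++⁻ : ∀ (s₁ s₂ t₁ t₂ : List ℕ) → length s₁ ≡ length t₁ → orderIso (s₁ ++ s₂) (t₁ ++ t₂) ≡ true →
               orderIso s₁ t₁ ≡ true × orderIso s₂ t₂ ≡ true
orderIso-++⁻ s₁ s₂ t₁ t₂ e iso =
    trans (orderIso≡allSameOrder s₁ t₁ e) (∧-conicalˡ _ _ diagonal)
  , trans (orderIso≡allSameOrder s₂ t₂ e₂) (∧-conicalʳ _ _ diagonal)
  where
  l l₁ l₂ : List (ℕ × ℕ)
  l = zip (s₁ ++ s₂) (t₁ ++ t₂)
  l₁ = zip s₁ t₁
  l₂ = zip s₂ t₂
  e₂ : length s₂ ≡ length t₂
  e₂ = ==ℕ⇒≡ _ _ (trans (sym (length-++-==ℕ s₁ s₂ t₁ t₂ e)) (∧-conicalˡ _ (allSameOrder l l) iso))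
  diagonal : allSameOrder l₁ l₁ ∧ allSameOrder l₂ l₂ ≡ true
  diagonal = ∧-conicalʳ (allSameOrder l₁ l₂ ∧ allSameOrder l₂ l₁) _ (trans (sym (allSameOrder-++ l₁ l₂))
                                   (trans (cong (λ ps → allSameOrder ps ps) (sym (zip-++ s₁ s₂ t₁ t₂ e)))
                                          (∧-conicalʳ _ _ iso)))

OrderPreserving : (ℕ → ℕ) → Set
OrderPreserving f = ∀ x y → (f x <ᵇ f y) ≡ (x <ᵇ y)

+-orderPreserving : ∀ c → OrderPreserving (λ x → c + x)
+-orderPreserving zero    x y = refl
+-orderPreserving (suc c) x y = +-orderPreserving c x y

allSameOrder-map : ∀ (g : ℕ × ℕ → ℕ × ℕ) → (∀ p q → sameOrder (g p) (g q) ≡ sameOrder p q) →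
                   ∀ l → allSameOrder (map g l) (map g l) ≡ allSameOrder l l
allSameOrder-map g g-same l =
  trans (all-map _ g l) (all-cong l (λ {p} _ → trans (all-map _ g l) (all-cong l (λ {q} _ → g-same p q))))

orderIso-mapˡ : ∀ {f} → OrderPreserving f → ∀ s t → orderIso (map f s) t ≡ orderIso s t
orderIso-mapˡ {f} f-mono s t = cong₂ _∧_ (cong (_==ℕ length t) (length-map f s)) (begin
  allSameOrder (zip (map f s) t) (zip (map f s) t)
    ≡⟨ cong (λ ps → allSameOrder ps ps) (trans (cong (zip (map f s)) (sym (map-id t))) (zip-map f id s t)) ⟩
  allSameOrder (map (Product.map f id) (zip s t)) (map (Product.map f id) (zip s t))
    ≡⟨ allSameOrder-map _ (λ p q → cong (_==ᵇ (proj₂ p <ᵇ proj₂ q)) (f-mono (proj₁ p) (proj₁ q))) (zip s t) ⟩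
  allSameOrder (zip s t) (zip s t) ∎)
  where open ≡-Reasoning

orderIso-mapʳ : ∀ {f} → OrderPreserving f → ∀ s t → orderIso s (map f t) ≡ orderIso s t
orderIso-mapʳ {f} f-mono s t = cong₂ _∧_ (cong (length s ==ℕ_) (length-map f t)) (begin
  allSameOrder (zip s (map f t)) (zip s (map f t))
    ≡⟨ cong (λ ps → allSameOrder ps ps) (trans (cong (λ s′ → zip s′ (map f t)) (sym (map-id s))) (zip-map id f s t)) ⟩
  allSameOrder (map (Product.map id f) (zip s t)) (map (Product.map id f) (zip s t))
    ≡⟨ allSameOrder-map _ (λ p q → cong ((proj₁ p <ᵇ proj₁ q) ==ᵇ_) (f-mono (proj₂ p) (proj₂ q))) (zip s t) ⟩
  allSameOrder (zip s t) (zip s t) ∎)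
  where open ≡-Reasoning

Separated : Bool → List ℕ → List ℕ → Set
Separated c xs ys = ∀ {x y} → x ∈ xs → y ∈ ys → (x <ᵇ y) ≡ c × (y <ᵇ x) ≡ not c

separatedᵇ : Bool → List ℕ → List ℕ → Bool
separatedᵇ c us vs = all (λ u → all (λ v → c ==ᵇ (u <ᵇ v)) vs) us
                   ∧ all (λ v → all (λ u → not c ==ᵇ (v <ᵇ u)) us) vs

separatedᵇ-[]ˡ : ∀ c v → separatedᵇ c [] v ≡ true
separatedᵇ-[]ˡ c []      = refl
separatedᵇ-[]ˡ c (_ ∷ v) = separatedᵇ-[]ˡ c v

separatedᵇ-[]ʳ : ∀ c u → separatedᵇ c u [] ≡ true
separatedᵇ-[]ʳ c []      = refl
separatedᵇ-[]ʳ c (_ ∷ u) = separatedᵇ-[]ʳ c u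

separatedᵇ-true⁺ : ∀ c u v → Separated c u v → separatedᵇ c u v ≡ true
separatedᵇ-true⁺ c u v sep = cong₂ _∧_
  (all-true⁺ _ u (λ x∈ → all-true⁺ _ v (λ y∈ → trans (cong (c ==ᵇ_) (proj₁ (sep x∈ y∈))) (==ᵇ-refl c))))
  (all-true⁺ _ v (λ y∈ → all-true⁺ _ u (λ x∈ → trans (cong (not c ==ᵇ_) (proj₂ (sep x∈ y∈))) (==ᵇ-refl (not c)))))

separatedᵇ-false⁺ : ∀ c u v {x y} → x ∈ u → y ∈ v → (x <ᵇ y) ≡ not c → separatedᵇ c u v ≡ false
separatedᵇ-false⁺ c u v x∈ y∈ x<ᵇy =
  cong (_∧ all (λ v′ → all (λ u′ → not c ==ᵇ (v′ <ᵇ u′)) u) v) (all-false⁺ _ u x∈ (all-false⁺ _ v y∈ (trans (cong (c ==ᵇ_) x<ᵇy) (c==ᵇnot-c c))))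
  where
  c==ᵇnot-c : ∀ c → (c ==ᵇ not c) ≡ false
  c==ᵇnot-c true  = refl
  c==ᵇnot-c false = refl

allSameOrder-across : ∀ d (s t s′ t′ : List ℕ) → length s ≡ length t → length s′ ≡ length t′ →
  (∀ {x y} → x ∈ s → y ∈ s′ → (x <ᵇ y) ≡ d) →
  allSameOrder (zip s t) (zip s′ t′) ≡ all (λ u → all (λ v → d ==ᵇ (u <ᵇ v)) t′) t
allSameOrder-across d []      []      s′ t′ _ _  _  = refl
allSameOrder-across d (x ∷ s) (u ∷ t) s′ t′ e e′ s<s′ =
  cong₂ _∧_ (row s′ t′ e′ (s<s′ (here refl))) (allSameOrder-across d s t s′ t′ (suc-injective e) e′ (s<s′ ∘ there))
  where
  row : ∀ (s′ t′ : List ℕ) → length s′ ≡ length t′ → (∀ {y} → y ∈ s′ → (x <ᵇ y) ≡ d) →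
        all (sameOrder (x , u)) (zip s′ t′) ≡ all (λ v → d ==ᵇ (u <ᵇ v)) t′
  row []       []       _ _   = refl
  row (y ∷ s′) (v ∷ t′) e x<s′ =
    cong₂ _∧_ (cong (_==ᵇ (u <ᵇ v)) (x<s′ (here refl))) (row s′ t′ (suc-injective e) (x<s′ ∘ there))

orderIso-++ : ∀ c (s₁ s₂ t₁ t₂ : List ℕ) → length s₁ ≡ length t₁ → Separated c s₁ s₂ →
  orderIso (s₁ ++ s₂) (t₁ ++ t₂) ≡ separatedᵇ c t₁ t₂ ∧ (orderIso s₁ t₁ ∧ orderIso s₂ t₂)
orderIso-++ c s₁ s₂ t₁ t₂ e sep with length s₂ ≟ length t₂
... | no ne = trans (cong (_∧ allSameOrder l l) (trans (length-++-==ℕ s₁ s₂ t₁ t₂ e) (≢⇒==ℕ-false ne)))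
                    (sym (begin
  separatedᵇ c t₁ t₂ ∧ (orderIso s₁ t₁ ∧ orderIso s₂ t₂)
    ≡⟨ cong (λ b → separatedᵇ c t₁ t₂ ∧ (orderIso s₁ t₁ ∧ (b ∧ allSameOrder l₂ l₂))) (≢⇒==ℕ-false ne) ⟩
  separatedᵇ c t₁ t₂ ∧ (orderIso s₁ t₁ ∧ false)
    ≡⟨ cong (separatedᵇ c t₁ t₂ ∧_) (∧-zeroʳ (orderIso s₁ t₁)) ⟩
  separatedᵇ c t₁ t₂ ∧ false
    ≡⟨ ∧-zeroʳ (separatedᵇ c t₁ t₂) ⟩
  false ∎))
  where
  open ≡-Reasoning
  l l₂ : List (ℕ × ℕ)
  l = zip (s₁ ++ s₂) (t₁ ++ t₂)
  l₂ = zip s₂ t₂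
... | yes e₂ = begin
  (length (s₁ ++ s₂) ==ℕ length (t₁ ++ t₂)) ∧ allSameOrder l l
    ≡⟨ cong₂ _∧_ (trans (length-++-==ℕ s₁ s₂ t₁ t₂ e) (≡⇒==ℕ e₂)) (cong (λ ps → allSameOrder ps ps) (zip-++ s₁ s₂ t₁ t₂ e)) ⟩
  allSameOrder (l₁ ++ l₂) (l₁ ++ l₂)
    ≡⟨ allSameOrder-++ l₁ l₂ ⟩
  (allSameOrder l₁ l₂ ∧ allSameOrder l₂ l₁) ∧ (allSameOrder l₁ l₁ ∧ allSameOrder l₂ l₂)
    ≡⟨ cong₂ _∧_ (cong₂ _∧_ (allSameOrder-across c s₁ t₁ s₂ t₂ e e₂ (λ x∈ y∈ → proj₁ (sep x∈ y∈)))
                            (allSameOrder-across (not c) s₂ t₂ s₁ t₁ e₂ e (λ y∈ x∈ → proj₂ (sep x∈ y∈))))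
                 (sym (cong₂ _∧_ (orderIso≡allSameOrder s₁ t₁ e) (orderIso≡allSameOrder s₂ t₂ e₂))) ⟩
  separatedᵇ c t₁ t₂ ∧ (orderIso s₁ t₁ ∧ orderIso s₂ t₂) ∎
  where
  open ≡-Reasoning
  l l₁ l₂ : List (ℕ × ℕ)
  l = zip (s₁ ++ s₂) (t₁ ++ t₂)
  l₁ = zip s₁ t₁
  l₂ = zip s₂ t₂

orderIso-++-split : ∀ c (s₁ s₂ τ : List ℕ) → Separated c s₁ s₂ → let j = length s₁ in
  orderIso (s₁ ++ s₂) τ ≡ separatedᵇ c (take j τ) (drop j τ) ∧ (orderIso s₁ (take j τ) ∧ orderIso s₂ (drop j τ))
orderIso-++-split c s₁ s₂ τ sep with length s₁ ≤? length τ
... | yes j≤ = begin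
  orderIso (s₁ ++ s₂) τ
    ≡⟨ cong (orderIso (s₁ ++ s₂)) (take++drop≡id j τ) ⟨
  orderIso (s₁ ++ s₂) (take j τ ++ drop j τ)
    ≡⟨ orderIso-++ c s₁ s₂ (take j τ) (drop j τ) (sym (trans (length-take j τ) (m≤n⇒m⊓n≡m j≤))) sep ⟩
  separatedᵇ c (take j τ) (drop j τ) ∧ (orderIso s₁ (take j τ) ∧ orderIso s₂ (drop j τ)) ∎
  where
  open ≡-Reasoning
  j : ℕ
  j = length s₁
... | no j≰ = trans (cong (_∧ allSameOrder l l) (≢⇒==ℕ-false (λ e → <-irrefl (sym e) τ<s₁++s₂)))
                    (sym (begin
  separatedᵇ c (take j τ) (drop j τ) ∧ (orderIso s₁ (take j τ) ∧ orderIso s₂ (drop j τ))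
    ≡⟨ cong (λ t → separatedᵇ c t (drop j τ) ∧ (orderIso s₁ t ∧ orderIso s₂ (drop j τ))) (take-all j τ (<⇒≤ τ<j)) ⟩
  separatedᵇ c τ (drop j τ) ∧ (orderIso s₁ τ ∧ orderIso s₂ (drop j τ))
    ≡⟨ cong (λ b → separatedᵇ c τ (drop j τ) ∧ ((b ∧ allSameOrder (zip s₁ τ) (zip s₁ τ)) ∧ orderIso s₂ (drop j τ)))
            (≢⇒==ℕ-false (λ e → <-irrefl (sym e) τ<j)) ⟩
  separatedᵇ c τ (drop j τ) ∧ false
    ≡⟨ ∧-zeroʳ _ ⟩
  false ∎))
  where
  open ≡-Reasoning
  j : ℕ
  j = length s₁
  l : List (ℕ × ℕ)
  l = zip (s₁ ++ s₂) τ
  τ<j : length τ < j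
  τ<j = ≰⇒> j≰
  τ<s₁++s₂ : length τ < length (s₁ ++ s₂)
  τ<s₁++s₂ = <-≤-trans τ<j (subst (j ≤_) (sym (length-++ s₁)) (m≤m+n j (length s₂)))

contains-[] : ∀ X → contains X [] ≡ true
contains-[] X = any-true⁺ (λ s → orderIso s []) (subseqs X) ([]∈subseqs X) refl

contains-[-][-] : ∀ n t → contains (n ∷ []) (t ∷ []) ≡ true
contains-[-][-] n t rewrite <ᵇ-false {n} ≤-refl | <ᵇ-false {t} ≤-refl = refl

contains-++⁻ : ∀ X σ ρ → contains X (σ ++ ρ) ≡ true → contains X σ ≡ true × contains X ρ ≡ true
contains-++⁻ X σ ρ X⊇σρ with any-true⁻ (λ s → orderIso s (σ ++ ρ)) (subseqs X) X⊇σρ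
... | s , s∈ , s≅σρ = any-true⁺ _ (subseqs X) (take∈subseqs j X s∈) (proj₁ parts)
                    , any-true⁺ _ (subseqs X) (drop∈subseqs j X s∈) (proj₂ parts)
  where
  j : ℕ
  j = length σ
  |s| : length s ≡ j + length ρ
  |s| = trans (==ℕ⇒≡ _ _ (∧-conicalˡ _ _ s≅σρ)) (length-++ σ)
  |take-j-s| : length (take j s) ≡ j
  |take-j-s| = trans (length-take j s) (m≤n⇒m⊓n≡m (subst (j ≤_) (sym |s|) (m≤m+n j (length ρ))))
  parts : orderIso (take j s) σ ≡ true × orderIso (drop j s) ρ ≡ true
  parts = orderIso-++⁻ (take j s) (drop j s) σ ρ |take-j-s|
            (trans (cong (λ s′ → orderIso s′ (σ ++ ρ)) (take++drop≡id j s)) s≅σρ)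

contains-mapˡ : ∀ {f} → OrderPreserving f → ∀ X σ → contains (map f X) σ ≡ contains X σ
contains-mapˡ {f} f-mono X σ = begin
  any (λ s → orderIso s σ) (subseqs (map f X))       ≡⟨ cong (any (λ s → orderIso s σ)) (subseqs-map f X) ⟩
  any (λ s → orderIso s σ) (map (map f) (subseqs X)) ≡⟨ any-map (λ s → orderIso s σ) (map f) (subseqs X) ⟩
  any (λ s → orderIso (map f s) σ) (subseqs X)       ≡⟨ any-cong (subseqs X) (λ {s} _ → orderIso-mapˡ f-mono s σ) ⟩
  any (λ s → orderIso s σ) (subseqs X)               ∎
  where open ≡-Reasoning

contains-mapʳ : ∀ {f} → OrderPreserving f → ∀ X σ → contains X (map f σ) ≡ contains X σ
contains-mapʳ f-mono X σ = any-cong (subseqs X) (λ {s} _ → orderIso-mapʳ f-mono s σ)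

anySplit : (List ℕ → List ℕ → Bool) → List ℕ → Bool
anySplit g []       = g [] []
anySplit g (t ∷ ts) = g [] (t ∷ ts) ∨ anySplit (λ u v → g (t ∷ u) v) ts

anySplit-cong : ∀ {g h : List ℕ → List ℕ → Bool} τ → (∀ u v → u ++ v ≡ τ → g u v ≡ h u v) →
                anySplit g τ ≡ anySplit h τ
anySplit-cong []       g≡h = g≡h [] [] refl
anySplit-cong (t ∷ ts) g≡h =
  cong₂ _∨_ (g≡h [] (t ∷ ts) refl) (anySplit-cong ts (λ u v e → g≡h (t ∷ u) v (cong (t ∷_) e)))

anySplit-false : ∀ (g : List ℕ → List ℕ → Bool) τ → (∀ u v → u ++ v ≡ τ → g u v ≡ false) → anySplit g τ ≡ false
anySplit-false g τ g≡false = trans (anySplit-cong τ g≡false) (anySplit-const τ)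
  where
  anySplit-const : ∀ τ → anySplit (λ _ _ → false) τ ≡ false
  anySplit-const []       = refl
  anySplit-const (t ∷ ts) = anySplit-const ts

anySplit-at : ∀ (g : List ℕ → List ℕ → Bool) j τ → (∀ u v → length u ≢ j → g u v ≡ false) →
              anySplit g τ ≡ g (take j τ) (drop j τ)
anySplit-at g zero    []       _     = refl
anySplit-at g (suc j) []       _     = refl
anySplit-at g zero    (t ∷ ts) other =
  trans (cong (g [] (t ∷ ts) ∨_) (anySplit-false _ ts (λ u v _ → other (t ∷ u) v (λ ())))) (∨-identityʳ _)
anySplit-at g (suc j) (t ∷ ts) other =
  trans (cong (_∨ anySplit (λ u v → g (t ∷ u) v) ts) (other [] (t ∷ ts) (λ ())))
        (anySplit-at (λ u v → g (t ∷ u) v) j ts (λ u v ne → other (t ∷ u) v (ne ∘ suc-injective)))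

any-anySplit : ∀ {A : Set} (G : A → List ℕ → List ℕ → Bool) xs τ →
               any (λ x → anySplit (G x) τ) xs ≡ anySplit (λ u v → any (λ x → G x u v) xs) τ
any-anySplit G xs []       = refl
any-anySplit G xs (t ∷ ts) =
  trans (any-∨ (λ x → G x [] (t ∷ ts)) (λ x → anySplit (λ u v → G x (t ∷ u) v) ts) xs)
        (cong (any (λ x → G x [] (t ∷ ts)) xs ∨_) (any-anySplit (λ x u v → G x (t ∷ u) v) xs ts))

containsSplit : Bool → List ℕ → List ℕ → List ℕ → List ℕ → Bool
containsSplit c X Y u v = separatedᵇ c u v ∧ (contains X u ∧ contains Y v)

contains-++ : ∀ c (X Y τ : List ℕ) → Separated c X Y → contains (X ++ Y) τ ≡ anySplit (containsSplit c X Y) τ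
contains-++ c X Y τ sep = begin
  any (λ s → orderIso s τ) (subseqs (X ++ Y))
    ≡⟨ any-subseqs-++ (λ s → orderIso s τ) X Y ⟩
  any (λ s → any (λ t → orderIso (s ++ t) τ) (subseqs Y)) (subseqs X)
    ≡⟨ any-cong (subseqs X) (λ s∈ → any-cong (subseqs Y) (λ t∈ → split s∈ t∈)) ⟩
  any (λ s → any (λ t → anySplit (G s t) τ) (subseqs Y)) (subseqs X)
    ≡⟨ any-cong (subseqs X) (λ {s} _ → any-anySplit (G s) (subseqs Y) τ) ⟩
  any (λ s → anySplit (λ u v → any (λ t → G s t u v) (subseqs Y)) τ) (subseqs X)
    ≡⟨ any-anySplit (λ s u v → any (λ t → G s t u v) (subseqs Y)) (subseqs X) τ ⟩
  anySplit (λ u v → any (λ s → any (λ t → G s t u v) (subseqs Y)) (subseqs X)) τ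
    ≡⟨ anySplit-cong τ (λ u v _ → factor u v) ⟩
  anySplit (containsSplit c X Y) τ ∎
  where
  open ≡-Reasoning
  G : List ℕ → List ℕ → List ℕ → List ℕ → Bool
  G s t u v = separatedᵇ c u v ∧ (orderIso s u ∧ orderIso t v)
  wrong-length : ∀ s t u v → length u ≢ length s → G s t u v ≡ false
  wrong-length s t u v ne = trans (cong (λ b → separatedᵇ c u v ∧ ((b ∧ allSameOrder (zip s u) (zip s u)) ∧ orderIso t v))
                                        (≢⇒==ℕ-false (ne ∘ sym)))
                                  (∧-zeroʳ _)
  split : ∀ {s t} → s ∈ subseqs X → t ∈ subseqs Y → orderIso (s ++ t) τ ≡ anySplit (G s t) τ
  split {s} {t} s∈ t∈ =
    trans (orderIso-++-split c s t τ (λ x∈ y∈ → sep (∈subseqs⇒⊆ X s∈ x∈) (∈subseqs⇒⊆ Y t∈ y∈)))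
          (sym (anySplit-at (G s t) (length s) τ (wrong-length s t)))
  factor : ∀ u v → any (λ s → any (λ t → G s t u v) (subseqs Y)) (subseqs X) ≡ separatedᵇ c u v ∧ (contains X u ∧ contains Y v)
  factor u v = begin
    any (λ s → any (λ t → G s t u v) (subseqs Y)) (subseqs X)
      ≡⟨ any-cong (subseqs X) (λ {s} _ → trans (any-∧ˡ (separatedᵇ c u v) _ (subseqs Y))
                                                (cong (separatedᵇ c u v ∧_) (any-∧ˡ (orderIso s u) _ (subseqs Y)))) ⟩
    any (λ s → separatedᵇ c u v ∧ (orderIso s u ∧ contains Y v)) (subseqs X)
      ≡⟨ any-∧ˡ (separatedᵇ c u v) _ (subseqs X) ⟩
    separatedᵇ c u v ∧ any (λ s → orderIso s u ∧ contains Y v) (subseqs X)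
      ≡⟨ cong (separatedᵇ c u v ∧_) (any-∧ʳ (contains Y v) (λ s → orderIso s u) (subseqs X)) ⟩
    separatedᵇ c u v ∧ (contains X u ∧ contains Y v) ∎

anySplit-++ : ∀ (g : List ℕ → List ℕ → Bool) σ ρ → (∀ u y w → u ++ y ∷ w ≡ σ → g u (y ∷ w ++ ρ) ≡ false) →
              anySplit g (σ ++ ρ) ≡ anySplit (λ u v → g (σ ++ u) v) ρ
anySplit-++ g []      ρ _     = refl
anySplit-++ g (s ∷ σ) ρ early =
  cong₂ _∨_ (early [] s σ refl) (anySplit-++ (λ u v → g (s ∷ u) v) σ ρ (λ u y w e → early (s ∷ u) y w (cong (s ∷_) e)))

anySplit-ends : ∀ (g : List ℕ → List ℕ → Bool) τ → AllPairs _<_ τ →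
                (∀ x u y v → x < y → g (x ∷ u) (y ∷ v) ≡ false) → anySplit g τ ≡ g [] τ ∨ g τ []
anySplit-ends g []       _              _     = sym (∨-idem (g [] []))
anySplit-ends g (t ∷ ts) (t<ts ∷ _) inner = cong (g [] (t ∷ ts) ∨_) (begin
  anySplit (λ u v → g (t ∷ u) v) ts
    ≡⟨ cong (anySplit (λ u v → g (t ∷ u) v)) (++-identityʳ ts) ⟨
  anySplit (λ u v → g (t ∷ u) v) (ts ++ [])
    ≡⟨ anySplit-++ (λ u v → g (t ∷ u) v) ts [] (λ u y w e → inner t u y (w ++ []) (All.lookup t<ts (y∈ u e))) ⟩
  g (t ∷ ts ++ []) []
    ≡⟨ cong (λ τ → g (t ∷ τ) []) (++-identityʳ ts) ⟩
  g (t ∷ ts) [] ∎)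
  where
  open ≡-Reasoning
  y∈ : ∀ u {y w} → u ++ y ∷ w ≡ ts → y ∈ ts
  y∈ u e = subst (_ ∈_) e (∈-++⁺ʳ u (here refl))

containsSplit-[]ˡ : ∀ c X Y τ → containsSplit c X Y [] τ ≡ contains Y τ
containsSplit-[]ˡ c X Y τ rewrite separatedᵇ-[]ˡ c τ | contains-[] X = refl

containsSplit-[]ʳ : ∀ c X Y τ → containsSplit c X Y τ [] ≡ contains X τ
containsSplit-[]ʳ c X Y τ rewrite separatedᵇ-[]ʳ c τ | contains-[] Y = ∧-identityʳ _

containsSplit-false⁺ : ∀ c X Y u v {x y} → x ∈ u → y ∈ v → (x <ᵇ y) ≡ not c → containsSplit c X Y u v ≡ false
containsSplit-false⁺ c X Y u v x∈ y∈ x<ᵇy = cong (_∧ (contains X u ∧ contains Y v)) (separatedᵇ-false⁺ c u v x∈ y∈ x<ᵇy)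

-- X lies above Y, so an increasing pattern cannot straddle the two blocks.
contains-++-increasing : ∀ X Y τ → Separated false X Y → AllPairs _<_ τ →
                         contains (X ++ Y) τ ≡ contains Y τ ∨ contains X τ
contains-++-increasing X Y τ sep τ↑ = begin
  contains (X ++ Y) τ
    ≡⟨ contains-++ false X Y τ sep ⟩
  anySplit (containsSplit false X Y) τ
    ≡⟨ anySplit-ends _ τ τ↑ (λ x u y v x<y → containsSplit-false⁺ false X Y (x ∷ u) (y ∷ v) (here refl) (here refl) (<ᵇ-true x<y)) ⟩
  containsSplit false X Y [] τ ∨ containsSplit false X Y τ []
    ≡⟨ cong₂ _∨_ (containsSplit-[]ˡ false X Y τ) (containsSplit-[]ʳ false X Y τ) ⟩
  contains Y τ ∨ contains X τ ∎
  where open ≡-Reasoning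

contains-++-[-] : ∀ X n σ t → Separated true X (n ∷ []) →
  contains (X ++ n ∷ []) (σ ++ t ∷ []) ≡ (separatedᵇ true σ (t ∷ []) ∧ contains X σ) ∨ contains X (σ ++ t ∷ [])
contains-++-[-] X n σ t sep = begin
  contains (X ++ n ∷ []) (σ ++ t ∷ [])
    ≡⟨ contains-++ true X (n ∷ []) (σ ++ t ∷ []) sep ⟩
  anySplit g (σ ++ t ∷ [])
    ≡⟨ anySplit-++ g σ (t ∷ []) (λ u y w _ → too-long u y w) ⟩
  g (σ ++ []) (t ∷ []) ∨ g (σ ++ t ∷ []) []
    ≡⟨ cong₂ _∨_ (trans (cong (λ σ′ → g σ′ (t ∷ [])) (++-identityʳ σ)) last) (containsSplit-[]ʳ true X (n ∷ []) (σ ++ t ∷ [])) ⟩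
  (separatedᵇ true σ (t ∷ []) ∧ contains X σ) ∨ contains X (σ ++ t ∷ []) ∎
  where
  open ≡-Reasoning
  g : List ℕ → List ℕ → Bool
  g = containsSplit true X (n ∷ [])
  too-long : ∀ u y w → g u (y ∷ w ++ t ∷ []) ≡ false
  too-long u y []      = trans (cong (separatedᵇ true u (y ∷ t ∷ []) ∧_) (∧-zeroʳ (contains X u))) (∧-zeroʳ _)
  too-long u y (z ∷ w) = trans (cong (separatedᵇ true u (y ∷ z ∷ w ++ t ∷ []) ∧_) (∧-zeroʳ (contains X u))) (∧-zeroʳ _)
  last : g σ (t ∷ []) ≡ separatedᵇ true σ (t ∷ []) ∧ contains X σ
  last rewrite contains-[-][-] n t = cong (separatedᵇ true σ (t ∷ []) ∧_) (∧-identityʳ (contains X σ))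

contains-++-[-]-below : ∀ X n σ t → Separated true X (n ∷ []) → (∀ {x} → x ∈ σ → x < t) →
                        contains (X ++ n ∷ []) (σ ++ t ∷ []) ≡ contains X σ
contains-++-[-]-below X n σ t sep σ<t = begin
  contains (X ++ n ∷ []) (σ ++ t ∷ [])
    ≡⟨ contains-++-[-] X n σ t sep ⟩
  (separatedᵇ true σ (t ∷ []) ∧ contains X σ) ∨ contains X (σ ++ t ∷ [])
    ≡⟨ cong (λ b → (b ∧ contains X σ) ∨ contains X (σ ++ t ∷ []))
            (separatedᵇ-true⁺ true σ (t ∷ []) λ { x∈ (here refl) → <ᵇ-true (σ<t x∈) , <ᵇ-false (<⇒≤ (σ<t x∈)) }) ⟩
  contains X σ ∨ contains X (σ ++ t ∷ [])
    ≡⟨ absorb (contains X σ) (contains X (σ ++ t ∷ [])) (proj₁ ∘ contains-++⁻ X σ (t ∷ [])) ⟩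
  contains X σ ∎
  where
  open ≡-Reasoning
  absorb : ∀ a b → (b ≡ true → a ≡ true) → a ∨ b ≡ a
  absorb true  b     _   = refl
  absorb false false _   = refl
  absorb false true  b⇒a = sym (b⇒a refl)

contains-++-[-]-above : ∀ X n σ t → Separated true X (n ∷ []) → ∀ {x} → x ∈ σ → t < x →
                        contains (X ++ n ∷ []) (σ ++ t ∷ []) ≡ contains X (σ ++ t ∷ [])
contains-++-[-]-above X n σ t sep x∈ t<x =
  trans (contains-++-[-] X n σ t sep)
        (cong (λ b → (b ∧ contains X σ) ∨ contains X (σ ++ t ∷ []))
              (separatedᵇ-false⁺ true σ (t ∷ []) x∈ (here refl) (<ᵇ-false (<⇒≤ t<x))))

-- For τ = U ++ L with U above L (both increasing), the only straddling occurrence puts U in X and L in Y.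
contains-++-blocks : ∀ X Y s U L → Separated false X Y → AllPairs _<_ (s ∷ U) → AllPairs _<_ L →
  (∀ {x y} → x ∈ s ∷ U → y ∈ L → y < x) →
  contains (X ++ Y) (s ∷ U ++ L) ≡ contains Y (s ∷ U ++ L) ∨ ((contains X (s ∷ U) ∧ contains Y L) ∨ contains X (s ∷ U ++ L))
contains-++-blocks X Y s U L sep (s<U ∷ _) L↑ L<U = begin
  contains (X ++ Y) (s ∷ U ++ L)
    ≡⟨ contains-++ false X Y (s ∷ U ++ L) sep ⟩
  g [] (s ∷ U ++ L) ∨ anySplit (λ u v → g (s ∷ u) v) (U ++ L)
    ≡⟨ cong₂ _∨_ (containsSplit-[]ˡ false X Y (s ∷ U ++ L)) (anySplit-++ (λ u v → g (s ∷ u) v) U L inside-U) ⟩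
  contains Y (s ∷ U ++ L) ∨ anySplit (λ u v → g (s ∷ U ++ u) v) L
    ≡⟨ cong (contains Y (s ∷ U ++ L) ∨_) (anySplit-ends (λ u v → g (s ∷ U ++ u) v) L L↑ inside-L) ⟩
  contains Y (s ∷ U ++ L) ∨ (g (s ∷ U ++ []) L ∨ g (s ∷ U ++ L) [])
    ≡⟨ cong (contains Y (s ∷ U ++ L) ∨_) (cong₂ _∨_ (trans (cong (λ U′ → g (s ∷ U′) L) (++-identityʳ U)) at-L)
                                                      (containsSplit-[]ʳ false X Y (s ∷ U ++ L))) ⟩
  contains Y (s ∷ U ++ L) ∨ ((contains X (s ∷ U) ∧ contains Y L) ∨ contains X (s ∷ U ++ L)) ∎
  where
  open ≡-Reasoning
  g : List ℕ → List ℕ → Bool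
  g = containsSplit false X Y
  inside-U : ∀ u y w → u ++ y ∷ w ≡ U → g (s ∷ u) (y ∷ w ++ L) ≡ false
  inside-U u y w e = containsSplit-false⁺ false X Y (s ∷ u) (y ∷ w ++ L) (here refl) (here refl)
                       (<ᵇ-true (All.lookup s<U (subst (y ∈_) e (∈-++⁺ʳ u (here refl)))))
  inside-L : ∀ x u y v → x < y → g (s ∷ U ++ x ∷ u) (y ∷ v) ≡ false
  inside-L x u y v x<y = containsSplit-false⁺ false X Y (s ∷ U ++ x ∷ u) (y ∷ v) (there (∈-++⁺ʳ U (here refl))) (here refl) (<ᵇ-true x<y)
  at-L : g (s ∷ U) L ≡ contains X (s ∷ U) ∧ contains Y L
  at-L = cong (_∧ (contains X (s ∷ U) ∧ contains Y L))
              (separatedᵇ-true⁺ false (s ∷ U) L (λ x∈ y∈ → <ᵇ-false (<⇒≤ (L<U x∈ y∈)) , <ᵇ-true (L<U x∈ y∈)))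

-- The shape of a permutation around its maximum n when it avoids 132: X ++ n ∷ Y with X above Y.
Layered : List ℕ → ℕ → List ℕ → Set
Layered X n Y = All (_< n) X × All (_< n) Y × All (λ x → All (_< x) Y) X

below-separated : ∀ {X n} → All (_< n) X → Separated true X (n ∷ [])
below-separated X<n x∈ (here refl) = <ᵇ-true (All.lookup X<n x∈) , <ᵇ-false (<⇒≤ (All.lookup X<n x∈))

layered-separated : ∀ {X n Y} → Layered X n Y → Separated false (X ++ n ∷ []) Y
layered-separated {X} (X<n , Y<n , Y<X) {x} x∈ y∈ with ∈-++⁻ X x∈
... | inj₁ x∈X         = let y<x = All.lookup (All.lookup Y<X x∈X) y∈ in <ᵇ-false (<⇒≤ y<x) , <ᵇ-true y<x
... | inj₂ (here refl) = let y<n = All.lookup Y<n y∈ in <ᵇ-false (<⇒≤ y<n) , <ᵇ-true y<n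

avoids-∨ : ∀ a b → (if a ∨ b then false else true) ≡ (if a then false else true) ∧ (if b then false else true)
avoids-∨ true  b = refl
avoids-∨ false b = refl

avoids-132-layered : ∀ X n Y → Layered X n Y → avoids (X ++ n ∷ Y) p132 ≡ avoids X p132 ∧ avoids Y p132
avoids-132-layered X n Y L@(X<n , _ , _) = begin
  avoids (X ++ n ∷ Y) p132
    ≡⟨ cong (λ α → avoids α p132) (++-assoc X (n ∷ []) Y) ⟨
  avoids ((X ++ n ∷ []) ++ Y) p132
    ≡⟨ cong (λ b → if b then false else true) (contains-++ false (X ++ n ∷ []) Y p132 (layered-separated L)) ⟩
  -- the splits 1 | 3 2 and 1 3 | 2 of 132 are not separated, so they evaluate to false
  (if g [] p132 ∨ (false ∨ (false ∨ g p132 [])) then false else true)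
    ≡⟨ cong (λ b → if b then false else true) (cong₂ (λ a b → a ∨ (false ∨ (false ∨ b)))
              (containsSplit-[]ˡ false (X ++ n ∷ []) Y p132)
              (trans (containsSplit-[]ʳ false (X ++ n ∷ []) Y p132)
                     (contains-++-[-]-above X n (1 ∷ 3 ∷ []) 2 (below-separated X<n) (there (here refl)) (s≤s (s≤s (s≤s z≤n)))))) ⟩
  (if contains Y p132 ∨ contains X p132 then false else true)
    ≡⟨ cong (λ b → if b then false else true) (∨-comm (contains Y p132) (contains X p132)) ⟩
  (if contains X p132 ∨ contains Y p132 then false else true)
    ≡⟨ avoids-∨ (contains X p132) (contains Y p132) ⟩
  avoids X p132 ∧ avoids Y p132 ∎
  where
  open ≡-Reasoning
  g : List ℕ → List ℕ → Bool
  g = containsSplit false (X ++ n ∷ []) Y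

upTo↑ : ∀ j → AllPairs _<_ (upTo j)
upTo↑ j = AllPairs.applyUpTo⁺₁ id j (λ i<k _ → i<k)

contains-++-[-]-upTo : ∀ X n j → All (_< n) X → contains (X ++ n ∷ []) (upTo (suc j)) ≡ contains X (upTo j)
contains-++-[-]-upTo X n j X<n =
  trans (cong (contains (X ++ n ∷ [])) (sym (upTo-∷ʳ j)))
        (contains-++-[-]-below X n (upTo j) j (below-separated X<n) (All.lookup (all-upTo j)))

avoids-upTo-layered : ∀ X n Y j → Layered X n Y →
                      avoids (X ++ n ∷ Y) (upTo (suc j)) ≡ avoids X (upTo j) ∧ avoids Y (upTo (suc j))
avoids-upTo-layered X n Y j L@(X<n , _ , _) = begin
  avoids (X ++ n ∷ Y) (upTo (suc j))
    ≡⟨ cong (λ α → avoids α (upTo (suc j))) (++-assoc X (n ∷ []) Y) ⟨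
  avoids ((X ++ n ∷ []) ++ Y) (upTo (suc j))
    ≡⟨ cong (λ b → if b then false else true) (contains-++-increasing (X ++ n ∷ []) Y (upTo (suc j)) (layered-separated L) (upTo↑ (suc j))) ⟩
  (if contains Y (upTo (suc j)) ∨ contains (X ++ n ∷ []) (upTo (suc j)) then false else true)
    ≡⟨ cong (λ b → if contains Y (upTo (suc j)) ∨ b then false else true) (contains-++-[-]-upTo X n j X<n) ⟩
  (if contains Y (upTo (suc j)) ∨ contains X (upTo j) then false else true)
    ≡⟨ cong (λ b → if b then false else true) (∨-comm (contains Y (upTo (suc j))) (contains X (upTo j))) ⟩
  (if contains X (upTo j) ∨ contains Y (upTo (suc j)) then false else true)
    ≡⟨ avoids-∨ (contains X (upTo j)) (contains Y (upTo (suc j))) ⟩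
  avoids X (upTo j) ∧ avoids Y (upTo (suc j)) ∎
  where open ≡-Reasoning

kmUpper : ℕ → ℕ → List ℕ
kmUpper a m = map (λ i → m + suc i) (upTo (suc a))

kmLower : ℕ → List ℕ
kmLower m = map suc (upTo m)

kmPattern≡ : ∀ a m → kmPattern (suc (a + m)) m ≡ kmUpper a m ++ kmLower m
kmPattern≡ a m = cong (λ l → map (λ i → m + suc i) (upTo l) ++ kmLower m) (m+n∸n≡m (suc a) m)

kmUpper↑ : ∀ a m → AllPairs _<_ (kmUpper a m)
kmUpper↑ a m = AllPairs.map⁺ (AllPairs-map (λ i<j → +-monoʳ-< m (s≤s i<j)) (upTo↑ (suc a)))

kmLower↑ : ∀ m → AllPairs _<_ (kmLower m)
kmLower↑ m = AllPairs.map⁺ (AllPairs-map s≤s (upTo↑ m))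

kmLower<kmUpper : ∀ a m {x y} → x ∈ kmUpper a m → y ∈ kmLower m → y < x
kmLower<kmUpper a m x∈ y∈ with ∈-map⁻ (λ i → m + suc i) x∈ | ∈-map⁻ suc y∈
... | i , _ , refl | j , j∈ , refl = subst (suc (suc j) ≤_) (sym (+-suc m i)) (s≤s (≤-trans (All.lookup (all-upTo m) j∈) (m≤m+n m i)))

kmUpper-orderPreserving : ∀ m → OrderPreserving (λ i → m + suc i)
kmUpper-orderPreserving m x y = +-orderPreserving m (suc x) (suc y)

contains-kmUpper : ∀ X a m → contains X (kmUpper a m) ≡ contains X (upTo (suc a))
contains-kmUpper X a m = contains-mapʳ (kmUpper-orderPreserving m) X (upTo (suc a))

contains-kmLower : ∀ X m → contains X (kmLower m) ≡ contains X (upTo m)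
contains-kmLower X m = contains-mapʳ {suc} (λ _ _ → refl) X (upTo m)

contains-km⇒U×L : ∀ X a m → contains X (kmPattern (suc (a + m)) m) ≡ true →
                   contains X (kmUpper a m) ≡ true × contains X (kmLower m) ≡ true
contains-km⇒U×L X a m X⊇τ = contains-++⁻ X (kmUpper a m) (kmLower m) (subst (λ τ → contains X τ ≡ true) (kmPattern≡ a m) X⊇τ)

contains-km⇒upTo-a : ∀ X a m → contains X (kmPattern (suc (a + m)) m) ≡ true → contains X (upTo a) ≡ true
contains-km⇒upTo-a X a m X⊇τ = proj₁ (contains-++⁻ X (upTo a) (a ∷ []) (subst (λ τ → contains X τ ≡ true) (sym (upTo-∷ʳ a)) X⊇upTo))
  where
  X⊇upTo : contains X (upTo (suc a)) ≡ true
  X⊇upTo = trans (sym (contains-kmUpper X a m)) (proj₁ (contains-km⇒U×L X a m X⊇τ))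

contains-km⇒upTo-m : ∀ X a m → contains X (kmPattern (suc (a + m)) m) ≡ true → contains X (upTo m) ≡ true
contains-km⇒upTo-m X a m X⊇τ = trans (sym (contains-kmLower X m)) (proj₂ (contains-km⇒U×L X a m X⊇τ))

avoids-km-layered : ∀ X n Y a m → 0 < m → Layered X n Y → let τ = kmPattern (suc (a + m)) m in
  avoids (X ++ n ∷ Y) τ ≡ (avoids X τ ∧ avoids Y τ) ∧ not (contains X (upTo a) ∧ contains Y (upTo m))
avoids-km-layered X n Y a (suc m) _ L@(X<n , _ , _) rewrite kmPattern≡ a (suc m) = begin
  avoids (X ++ n ∷ Y) (U ++ kmLower (suc m))
    ≡⟨ cong (λ α → avoids α (U ++ kmLower (suc m))) (++-assoc X (n ∷ []) Y) ⟨
  avoids ((X ++ n ∷ []) ++ Y) (U ++ kmLower (suc m))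
    ≡⟨ cong (λ b → if b then false else true)
            (contains-++-blocks (X ++ n ∷ []) Y (suc m + 1) _ (kmLower (suc m)) (layered-separated L)
                                (kmUpper↑ a (suc m)) (kmLower↑ (suc m)) (kmLower<kmUpper a (suc m))) ⟩
  (if contains Y τ ∨ ((contains (X ++ n ∷ []) U ∧ contains Y (kmLower (suc m))) ∨ contains (X ++ n ∷ []) τ) then false else true)
    ≡⟨ cong (λ b → if contains Y τ ∨ b then false else true)
            (cong₂ _∨_ (cong₂ _∧_ (trans (contains-kmUpper (X ++ n ∷ []) a (suc m)) (contains-++-[-]-upTo X n a X<n))
                                  (contains-kmLower Y (suc m)))
                       X+n⊇τ) ⟩
  (if contains Y τ ∨ ((contains X (upTo a) ∧ contains Y (upTo (suc m))) ∨ contains X τ) then false else true)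
    ≡⟨ regroup (contains Y τ) (contains X (upTo a) ∧ contains Y (upTo (suc m))) (contains X τ) ⟩
  (avoids X τ ∧ avoids Y τ) ∧ not (contains X (upTo a) ∧ contains Y (upTo (suc m))) ∎
  where
  open ≡-Reasoning
  U τ : List ℕ
  U = kmUpper a (suc m)
  τ = U ++ kmLower (suc m)
  τ≡ : τ ≡ (U ++ kmLower m) ++ suc m ∷ []
  τ≡ = begin
    U ++ map suc (upTo (suc m))          ≡⟨ cong (λ l → U ++ map suc l) (upTo-∷ʳ m) ⟨
    U ++ map suc (upTo m ++ m ∷ [])      ≡⟨ cong (U ++_) (map-++ suc (upTo m) (m ∷ [])) ⟩
    U ++ (kmLower m ++ suc m ∷ [])       ≡⟨ ++-assoc U (kmLower m) (suc m ∷ []) ⟨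
    (U ++ kmLower m) ++ suc m ∷ []       ∎
  X+n⊇τ : contains (X ++ n ∷ []) τ ≡ contains X τ
  X+n⊇τ = trans (cong (contains (X ++ n ∷ [])) τ≡)
                (trans (contains-++-[-]-above X n (U ++ kmLower m) (suc m) (below-separated X<n) (here refl) (m<m+n (suc m) z<s))
                       (cong (contains X) (sym τ≡)))
  regroup : ∀ p qr s → (if p ∨ (qr ∨ s) then false else true) ≡ ((if s then false else true) ∧ (if p then false else true)) ∧ not qr
  regroup true  qr    true  = refl
  regroup true  qr    false = refl
  regroup false true  true  = refl
  regroup false true  false = refl
  regroup false false true  = refl
  regroup false false false = refl

aboveᵇ : List ℕ → List ℕ → Bool
aboveᵇ P S = all (λ x → all (λ y → not (x <ᵇ y)) S) P

not-above⇒contains-132 : ∀ P n S → All (_< n) P → All (_< n) S → aboveᵇ P S ≡ false → avoids (P ++ n ∷ S) p132 ≡ false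
not-above⇒contains-132 P n S P<n S<n P≱S
  with all-false⁻ _ P P≱S
... | x , x∈ , x≱S with all-false⁻ _ S x≱S
... | y , y∈ , x≮y = cong (λ b → if b then false else true)
                          (any-true⁺ (λ s → orderIso s p132) (subseqs (P ++ n ∷ S)) x-n-y∈ (x-n-y≅132 x<y (All.lookup S<n y∈)))
  where
  x<y : x < y
  x<y = <ᵇ⇒< x y (Equivalence.from T-≡ (not-injective x≮y))
  x-n-y∈ : x ∷ n ∷ y ∷ [] ∈ subseqs (P ++ n ∷ S)
  x-n-y∈ = ++∈subseqs P (n ∷ S) ([-]∈subseqs P x∈) (∷∈subseqs n S ([-]∈subseqs S y∈))
  x-n-y≅132 : ∀ {x n y} → x < y → y < n → orderIso (x ∷ n ∷ y ∷ []) p132 ≡ true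
  x-n-y≅132 {x} {n} {y} x<y y<n
    rewrite <ᵇ-false {x} ≤-refl | <ᵇ-false {n} ≤-refl | <ᵇ-false {y} ≤-refl
          | <ᵇ-true x<y | <ᵇ-true y<n | <ᵇ-true (<-trans x<y y<n)
          | <ᵇ-false (<⇒≤ x<y) | <ᵇ-false (<⇒≤ y<n) | <ᵇ-false (<⇒≤ (<-trans x<y y<n)) = refl

∑ : {A : Set} → List A → (A → ℕ) → ℕ
∑ []       g = 0
∑ (x ∷ xs) g = g x + ∑ xs g

infix 5 ∑
syntax ∑ xs (λ x → e) = ∑[ x ← xs ] e

module _ {A : Set} where

  ∑-cong : ∀ {P : A → Set} {g h : A → ℕ} xs → All P xs → (∀ {x} → P x → g x ≡ h x) → ∑ xs g ≡ ∑ xs h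
  ∑-cong []       []         _   = refl
  ∑-cong (x ∷ xs) (px ∷ pxs) g≡h = cong₂ _+_ (g≡h px) (∑-cong xs pxs g≡h)

  ∑-cong′ : ∀ {g h : A → ℕ} xs → (∀ x → g x ≡ h x) → ∑ xs g ≡ ∑ xs h
  ∑-cong′ []       _   = refl
  ∑-cong′ (x ∷ xs) g≡h = cong₂ _+_ (g≡h x) (∑-cong′ xs g≡h)

  ∑-zero : ∀ (xs : List A) → ∑[ x ← xs ] 0 ≡ 0
  ∑-zero []       = refl
  ∑-zero (_ ∷ xs) = ∑-zero xs

  ∑-++ : ∀ xs ys (g : A → ℕ) → ∑ (xs ++ ys) g ≡ ∑ xs g + ∑ ys g
  ∑-++ []       ys g = refl
  ∑-++ (x ∷ xs) ys g = trans (cong (_+_ (g x)) (∑-++ xs ys g)) (sym (+-assoc (g x) _ _))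

  ∑-+ : ∀ xs (g h : A → ℕ) → ∑[ x ← xs ] (g x + h x) ≡ ∑ xs g + ∑ xs h
  ∑-+ []       g h = refl
  ∑-+ (x ∷ xs) g h = trans (cong (_+_ (g x + h x)) (∑-+ xs g h)) (+-+-interchange (g x) (h x) _ _)
    where
    +-+-interchange : ∀ a b c d → (a + b) + (c + d) ≡ (a + c) + (b + d)
    +-+-interchange = ℕ-solve-∀

  ∑-*ˡ : ∀ xs c (g : A → ℕ) → ∑[ x ← xs ] (c * g x) ≡ c * ∑ xs g
  ∑-*ˡ []       c g = sym (*-zeroʳ c)
  ∑-*ˡ (x ∷ xs) c g = trans (cong (_+_ (c * g x)) (∑-*ˡ xs c g)) (sym (*-distribˡ-+ c (g x) _))

module _ {A B : Set} where

  ∑-map : ∀ (f : A → B) xs (g : B → ℕ) → ∑ (map f xs) g ≡ ∑ xs (g ∘ f)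
  ∑-map f []       g = refl
  ∑-map f (x ∷ xs) g = cong (_+_ (g (f x))) (∑-map f xs g)

  ∑-concatMap : ∀ (f : A → List B) xs (g : B → ℕ) → ∑ (concatMap f xs) g ≡ ∑[ x ← xs ] ∑ (f x) g
  ∑-concatMap f []       g = refl
  ∑-concatMap f (x ∷ xs) g = trans (∑-++ (f x) (concatMap f xs) g) (cong (_+_ (∑ (f x) g)) (∑-concatMap f xs g))

  ∑-comm : ∀ xs ys (g : A → B → ℕ) → ∑[ x ← xs ] ∑[ y ← ys ] g x y ≡ ∑[ y ← ys ] ∑[ x ← xs ] g x y
  ∑-comm []       ys g = sym (∑-zero ys)
  ∑-comm (x ∷ xs) ys g = trans (cong (_+_ (∑ ys (g x))) (∑-comm xs ys g)) (sym (∑-+ ys (g x) _))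

  ∑-* : ∀ xs ys (g : A → ℕ) (h : B → ℕ) → ∑[ x ← xs ] ∑[ y ← ys ] (g x * h y) ≡ ∑ xs g * ∑ ys h
  ∑-* []       ys g h = refl
  ∑-* (x ∷ xs) ys g h = trans (cong₂ _+_ (∑-*ˡ ys (g x) h) (∑-* xs ys g h)) (sym (*-distribʳ-+ (∑ ys h) (g x) _))

⟦_⟧ : Bool → ℕ
⟦ b ⟧ = if b then 1 else 0

⟦∧⟧ : ∀ a b → ⟦ a ∧ b ⟧ ≡ ⟦ a ⟧ * ⟦ b ⟧
⟦∧⟧ true  true  = refl
⟦∧⟧ true  false = refl
⟦∧⟧ false b     = refl

length-filterᵇ : ∀ {A : Set} (p : A → Bool) xs → length (filterᵇ p xs) ≡ ∑[ x ← xs ] ⟦ p x ⟧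
length-filterᵇ p []       = refl
length-filterᵇ p (x ∷ xs) with p x
... | true  = cong suc (length-filterᵇ p xs)
... | false = length-filterᵇ p xs

-- Counting 132-avoiders by the position of the maximum

-- Weaker than being a permutation, but all that the counting needs.
Fits : ℕ → List ℕ → Set
Fits n β = length β ≡ n × All (_< n) β

insertions-length : ∀ x β → All (λ z → length z ≡ suc (length β)) (insertions x β)
insertions-length x []       = refl ∷ []
insertions-length x (y ∷ ys) = refl ∷ All.map⁺ (All.map (cong suc) (insertions-length x ys))

insertions-all : ∀ (h : ℕ → Bool) x β → All (λ z → all h z ≡ h x ∧ all h β) (insertions x β)
insertions-all h x []       = refl ∷ []
insertions-all h x (y ∷ ys) =
  refl ∷ All.map⁺ (All.map (λ all-z → trans (cong (h y ∧_) all-z) (x∧yz≈y∧xz (h y) (h x) (all h ys))) (insertions-all h x ys))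
  where
  x∧yz≈y∧xz : ∀ a b c → a ∧ (b ∧ c) ≡ b ∧ (a ∧ c)
  x∧yz≈y∧xz a b c = solve 3 (λ a b c → a :* (b :* c) := b :* (a :* c)) refl a b c
    where open ∨-∧-Solver

insertions-< : ∀ {n x} β → x < n → All (_< n) β → All (All (_< n)) (insertions x β)
insertions-< []       x<n []           = (x<n ∷ []) ∷ []
insertions-< (y ∷ ys) x<n (y<n ∷ ys<n) = (x<n ∷ y<n ∷ ys<n) ∷ All.map⁺ (All.map (y<n ∷_) (insertions-< ys x<n ys<n))

perms-fit : ∀ n → All (Fits n) (perms n)
perms-fit zero    = (refl , []) ∷ []
perms-fit (suc n) = All.concat⁺ (All.map⁺ (All.map insert-max (perms-fit n)))
  where
  insert-max : ∀ {β} → Fits n β → All (Fits (suc n)) (insertions n β)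
  insert-max {β} (|β| , β<n) = All.zipWith (λ (|z| , z<n) → trans |z| (cong suc |β|) , z<n)
    (insertions-length n β , insertions-< β (n<1+n n) (All.map m<n⇒m<1+n β<n))

-- Inserting x into β at a position ≤ j or > j.
∑-insertions-at : ∀ x (g : List ℕ → List ℕ → ℕ) j β → j < length β →
  ∑[ β′ ← insertions x β ] g (take (suc j) β′) (drop (suc j) β′) ≡
  (∑[ z ← insertions x (take j β) ] g z (drop j β)) + (∑[ γ ← insertions x (drop (suc j) β) ] g (take (suc j) β) γ)
∑-insertions-at x g zero    (y ∷ ys) _ =
  cong₂ _+_ (sym (+-identityʳ (g (x ∷ []) (y ∷ ys)))) (∑-map (y ∷_) (insertions x ys) _)
∑-insertions-at x g (suc j) (y ∷ ys) (s≤s j<ys) = begin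
  g (x ∷ y ∷ take j ys) (drop j ys) + ∑ (map (y ∷_) (insertions x ys)) G
    ≡⟨ cong (_+_ (g (x ∷ y ∷ take j ys) (drop j ys))) (trans (∑-map (y ∷_) (insertions x ys) G)
                                                             (∑-insertions-at x (λ u v → g (y ∷ u) v) j ys j<ys)) ⟩
  g (x ∷ y ∷ take j ys) (drop j ys) + ((∑[ z ← insertions x (take j ys) ] g (y ∷ z) (drop j ys)) + rest)
    ≡⟨ +-assoc (g (x ∷ y ∷ take j ys) (drop j ys)) _ rest ⟨
  g (x ∷ y ∷ take j ys) (drop j ys) + (∑[ z ← insertions x (take j ys) ] g (y ∷ z) (drop j ys)) + rest
    ≡⟨ cong (λ s → g (x ∷ y ∷ take j ys) (drop j ys) + s + rest) (∑-map (y ∷_) (insertions x (take j ys)) (λ z → g z (drop j ys))) ⟨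
  (∑[ z ← insertions x (y ∷ take j ys) ] g z (drop j ys)) + rest ∎
  where
  open ≡-Reasoning
  G : List ℕ → ℕ
  G β′ = g (take (2 + j) β′) (drop (2 + j) β′)
  rest : ℕ
  rest = ∑[ γ ← insertions x (drop (suc j) ys) ] g (y ∷ take (suc j) ys) γ

aboveᵇ-[]ʳ : ∀ P → aboveᵇ P [] ≡ true
aboveᵇ-[]ʳ []      = refl
aboveᵇ-[]ʳ (_ ∷ P) = aboveᵇ-[]ʳ P

∑-insertions-into-prefix : ∀ n P S (T : List ℕ → List ℕ → ℕ) → All (_< n) S →
  ∑[ z ← insertions n P ] ⟦ aboveᵇ z S ⟧ * T z S ≡ ⟦ aboveᵇ P S ⟧ * (∑[ z ← insertions n P ] T z S)
∑-insertions-into-prefix n P S T S<n =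
  trans (∑-cong (insertions n P) (insertions-all (λ x → all (λ y → not (x <ᵇ y)) S) n P)
                (λ {z} z≥S → cong (λ b → ⟦ b ⟧ * T z S) (trans z≥S (cong (_∧ aboveᵇ P S) n≥S))))
        (∑-*ˡ (insertions n P) ⟦ aboveᵇ P S ⟧ (λ z → T z S))
  where
  n≥S : all (λ y → not (n <ᵇ y)) S ≡ true
  n≥S = all-true⁺ _ S (λ y∈ → cong not (<ᵇ-false (<⇒≤ (All.lookup S<n y∈))))

∑-insertions-into-suffix : ∀ n y P S (T : List ℕ → List ℕ → ℕ) → y < n →
  ∑[ γ ← insertions n S ] ⟦ aboveᵇ (y ∷ P) γ ⟧ * T (y ∷ P) γ ≡ 0
∑-insertions-into-suffix n y P S T y<n =
  trans (∑-cong (insertions n S) (insertions-all (λ y′ → not (y <ᵇ y′)) n S)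
                (λ {γ} y≥γ → cong (λ b → ⟦ b ∧ aboveᵇ P γ ⟧ * T (y ∷ P) γ)
                                  (trans y≥γ (cong (λ b → not b ∧ all (λ y′ → not (y <ᵇ y′)) S) (<ᵇ-true y<n)))))
        (∑-zero (insertions n S))

-- Splitting after position j + 1: the maximum n is above the suffix only if it was inserted into the prefix.
∑-insertions-above : ∀ n β j (T : List ℕ → List ℕ → ℕ) → All (_< n) β → j < length β →
  ∑[ β′ ← insertions n β ] ⟦ aboveᵇ (take (suc j) β′) (drop (suc j) β′) ⟧ * T (take (suc j) β′) (drop (suc j) β′)
  ≡ ⟦ aboveᵇ (take j β) (drop j β) ⟧ * (∑[ z ← insertions n (take j β) ] T z (drop j β))
∑-insertions-above n β@(y ∷ ys) j T β<n@(y<n ∷ _) j<β = begin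
  ∑[ β′ ← insertions n β ] g (take (suc j) β′) (drop (suc j) β′)
    ≡⟨ ∑-insertions-at n g j β j<β ⟩
  (∑[ z ← insertions n (take j β) ] g z (drop j β)) + (∑[ γ ← insertions n (drop j ys) ] g (y ∷ take j ys) γ)
    ≡⟨ cong₂ _+_ (∑-insertions-into-prefix n (take j β) (drop j β) T (All.drop⁺ j β<n))
                 (∑-insertions-into-suffix n y (take j ys) (drop j ys) T y<n) ⟩
  ⟦ aboveᵇ (take j β) (drop j β) ⟧ * (∑[ z ← insertions n (take j β) ] T z (drop j β)) + 0
    ≡⟨ +-identityʳ _ ⟩
  ⟦ aboveᵇ (take j β) (drop j β) ⟧ * (∑[ z ← insertions n (take j β) ] T z (drop j β)) ∎
  where
  open ≡-Reasoning
  g : List ℕ → List ℕ → ℕ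
  g u v = ⟦ aboveᵇ u v ⟧ * T u v

∑-insertions-whole : ∀ n β (T : List ℕ → List ℕ → ℕ) →
  ∑[ β′ ← insertions n β ] ⟦ aboveᵇ (take (suc (length β)) β′) (drop (suc (length β)) β′) ⟧
                           * T (take (suc (length β)) β′) (drop (suc (length β)) β′)
  ≡ ⟦ aboveᵇ (take (length β) β) (drop (length β) β) ⟧ * (∑[ z ← insertions n (take (length β) β) ] T z (drop (length β) β))
∑-insertions-whole n β T = begin
  ∑[ β′ ← insertions n β ] G β′
    ≡⟨ ∑-cong (insertions n β) (insertions-length n β) (λ {β′} |β′| → whole β′ (≤-reflexive |β′|)) ⟩
  ∑[ β′ ← insertions n β ] T β′ []
    ≡⟨ +-identityʳ _ ⟨
  1 * (∑[ z ← insertions n β ] T z [])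
    ≡⟨ cong (λ b → ⟦ b ⟧ * (∑[ z ← insertions n β ] T z [])) (aboveᵇ-[]ʳ β) ⟨
  ⟦ aboveᵇ β [] ⟧ * (∑[ z ← insertions n β ] T z [])
    ≡⟨ cong₂ (λ P S → ⟦ aboveᵇ P S ⟧ * (∑[ z ← insertions n P ] T z S)) (take-all l β ≤-refl) (drop-all l β ≤-refl) ⟨
  ⟦ aboveᵇ (take l β) (drop l β) ⟧ * (∑[ z ← insertions n (take l β) ] T z (drop l β)) ∎
  where
  open ≡-Reasoning
  l : ℕ
  l = length β
  G : List ℕ → ℕ
  G β′ = ⟦ aboveᵇ (take (suc l) β′) (drop (suc l) β′) ⟧ * T (take (suc l) β′) (drop (suc l) β′)
  whole : ∀ β′ → length β′ ≤ suc l → G β′ ≡ T β′ []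
  whole β′ β′≤ rewrite take-all (suc l) β′ β′≤ | drop-all (suc l) β′ β′≤ | aboveᵇ-[]ʳ β′ = +-identityʳ _

∑-insertions-max : ∀ n β j (T : List ℕ → List ℕ → ℕ) → Fits n β → j ≤ n →
  ∑[ β′ ← insertions n β ] ⟦ aboveᵇ (take (suc j) β′) (drop (suc j) β′) ⟧ * T (take (suc j) β′) (drop (suc j) β′)
  ≡ ⟦ aboveᵇ (take j β) (drop j β) ⟧ * (∑[ z ← insertions n (take j β) ] T z (drop j β))
∑-insertions-max n β j T (|β| , β<n) j≤n with m≤n⇒m<n∨m≡n (subst (j ≤_) (sym |β|) j≤n)
... | inj₁ j<β    = ∑-insertions-above n β j T β<n j<β
... | inj₂ refl   = ∑-insertions-whole n β T

raise : ℕ → List ℕ → List ℕ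
raise c = map (λ x → c + x)

insertions-raise : ∀ c x a → map (raise c) (insertions x a) ≡ insertions (c + x) (raise c a)
insertions-raise c x []       = refl
insertions-raise c x (y ∷ ys) = cong ((c + x ∷ c + y ∷ raise c ys) ∷_) (begin
  map (raise c) (map (y ∷_) (insertions x ys))     ≡⟨ map-∘ (insertions x ys) ⟨
  map (raise c ∘ (y ∷_)) (insertions x ys)        ≡⟨ map-∘ (insertions x ys) ⟩
  map (c + y ∷_) (map (raise c) (insertions x ys)) ≡⟨ cong (map (c + y ∷_)) (insertions-raise c x ys) ⟩
  map (c + y ∷_) (insertions (c + x) (raise c ys)) ∎)
  where open ≡-Reasoning

∑-perms-above : ∀ n j → j ≤ n → (T : List ℕ → List ℕ → ℕ) →
  ∑[ β ← perms n ] ⟦ aboveᵇ (take j β) (drop j β) ⟧ * T (take j β) (drop j β) ≡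
  ∑[ a ← perms j ] ∑[ b ← perms (n ∸ j) ] T (raise (n ∸ j) a) b
∑-perms-above n       zero    _         T = trans (∑-cong′ (perms n) (λ β → +-identityʳ (T [] β))) (sym (+-identityʳ _))
∑-perms-above (suc n) (suc j) (s≤s j≤n) T = begin
  ∑ (concatMap (insertions n) (perms n)) G
    ≡⟨ ∑-concatMap (insertions n) (perms n) G ⟩
  ∑[ β ← perms n ] ∑ (insertions n β) G
    ≡⟨ ∑-cong (perms n) (perms-fit n) (λ {β} β-fits → ∑-insertions-max n β j T β-fits j≤n) ⟩
  ∑[ β ← perms n ] ⟦ aboveᵇ (take j β) (drop j β) ⟧ * T′ (take j β) (drop j β)
    ≡⟨ ∑-perms-above n j j≤n T′ ⟩
  ∑[ a ← perms j ] ∑[ b ← perms c ] ∑[ z ← insertions n (raise c a) ] T z b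
    ≡⟨ ∑-cong′ (perms j) (λ a → ∑-cong′ (perms c) (λ b → insert-max a b)) ⟩
  ∑[ a ← perms j ] ∑[ b ← perms c ] ∑[ a′ ← insertions j a ] T (raise c a′) b
    ≡⟨ ∑-cong′ (perms j) (λ a → ∑-comm (insertions j a) (perms c) (λ a′ b → T (raise c a′) b)) ⟨
  ∑[ a ← perms j ] ∑[ a′ ← insertions j a ] ∑[ b ← perms c ] T (raise c a′) b
    ≡⟨ ∑-concatMap (insertions j) (perms j) _ ⟨
  ∑[ a′ ← concatMap (insertions j) (perms j) ] ∑[ b ← perms c ] T (raise c a′) b ∎
  where
  open ≡-Reasoning
  c : ℕ
  c = n ∸ j
  G : List ℕ → ℕ
  G β′ = ⟦ aboveᵇ (take (suc j) β′) (drop (suc j) β′) ⟧ * T (take (suc j) β′) (drop (suc j) β′)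
  T′ : List ℕ → List ℕ → ℕ
  T′ P S = ∑[ z ← insertions n P ] T z S
  insert-max : ∀ a b → ∑[ z ← insertions n (raise c a) ] T z b ≡ ∑[ a′ ← insertions j a ] T (raise c a′) b
  insert-max a b = begin
    ∑[ z ← insertions n (raise c a) ] T z b       ≡⟨ cong (λ x → ∑[ z ← insertions x (raise c a) ] T z b) (m∸n+n≡m j≤n) ⟨
    ∑[ z ← insertions (c + j) (raise c a) ] T z b ≡⟨ cong (λ zs → ∑[ z ← zs ] T z b) (insertions-raise c j a) ⟨
    ∑[ z ← map (raise c) (insertions j a) ] T z b ≡⟨ ∑-map (raise c) (insertions j a) (λ z → T z b) ⟩
    ∑[ a′ ← insertions j a ] T (raise c a′) b     ∎

insertions≡ : ∀ x β → insertions x β ≡ map (λ p → take p β ++ x ∷ drop p β) (upTo (suc (length β)))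
insertions≡ x []       = refl
insertions≡ x (y ∷ ys) = cong ((x ∷ y ∷ ys) ∷_) (begin
  map (y ∷_) (insertions x ys)
    ≡⟨ cong (map (y ∷_)) (insertions≡ x ys) ⟩
  map (y ∷_) (map (λ p → take p ys ++ x ∷ drop p ys) (upTo (suc (length ys))))
    ≡⟨ map-∘ (upTo (suc (length ys))) ⟨
  map (λ p → y ∷ take p ys ++ x ∷ drop p ys) (upTo (suc (length ys)))
    ≡⟨ map-upTo _ (suc (length ys)) ⟩
  applyUpTo (λ p → y ∷ take p ys ++ x ∷ drop p ys) (suc (length ys))
    ≡⟨ map-applyUpTo suc _ (suc (length ys)) ⟨
  map (λ p → take p (y ∷ ys) ++ x ∷ drop p (y ∷ ys)) (applyUpTo suc (suc (length ys))) ∎)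
  where open ≡-Reasoning

count : (List ℕ → Bool) → ℕ → ℕ
count Q n = ∑[ α ← perms n ] ⟦ avoids α p132 ∧ Q α ⟧

count-suc : ∀ n (Q : List ℕ → Bool) → count Q (suc n) ≡
  ∑[ p ← upTo (suc n) ] ∑[ a ← perms p ] ∑[ b ← perms (n ∸ p) ] ⟦ avoids (raise (n ∸ p) a ++ n ∷ b) p132 ∧ Q (raise (n ∸ p) a ++ n ∷ b) ⟧
count-suc n Q = begin
  ∑ (concatMap (insertions n) (perms n)) G
    ≡⟨ ∑-concatMap (insertions n) (perms n) G ⟩
  ∑[ β ← perms n ] ∑ (insertions n β) G
    ≡⟨ ∑-cong (perms n) (perms-fit n) (λ {β} β-fits → by-position β β-fits) ⟩
  ∑[ β ← perms n ] ∑[ p ← upTo (suc n) ] ⟦ aboveᵇ (take p β) (drop p β) ⟧ * G (take p β ++ n ∷ drop p β)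
    ≡⟨ ∑-comm (perms n) (upTo (suc n)) _ ⟩
  ∑[ p ← upTo (suc n) ] ∑[ β ← perms n ] ⟦ aboveᵇ (take p β) (drop p β) ⟧ * G (take p β ++ n ∷ drop p β)
    ≡⟨ ∑-cong (upTo (suc n)) (all-upTo (suc n)) (λ {p} p<1+n → ∑-perms-above n p (≤-pred p<1+n) (λ P S → G (P ++ n ∷ S))) ⟩
  ∑[ p ← upTo (suc n) ] ∑[ a ← perms p ] ∑[ b ← perms (n ∸ p) ] G (raise (n ∸ p) a ++ n ∷ b) ∎
  where
  open ≡-Reasoning
  G : List ℕ → ℕ
  G α = ⟦ avoids α p132 ∧ Q α ⟧
  -- a 132-avoider has everything before its maximum above everything after it
  only-above : ∀ β p → All (_< n) β → G (take p β ++ n ∷ drop p β) ≡ ⟦ aboveᵇ (take p β) (drop p β) ⟧ * G (take p β ++ n ∷ drop p β)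
  only-above β p β<n with aboveᵇ (take p β) (drop p β) in above
  ... | true  = sym (+-identityʳ _)
  ... | false rewrite not-above⇒contains-132 (take p β) n (drop p β) (All.take⁺ p β<n) (All.drop⁺ p β<n) above = refl
  by-position : ∀ β → Fits n β → ∑ (insertions n β) G ≡ ∑[ p ← upTo (suc n) ] ⟦ aboveᵇ (take p β) (drop p β) ⟧ * G (take p β ++ n ∷ drop p β)
  by-position β (|β| , β<n) = begin
    ∑ (insertions n β) G
      ≡⟨ cong (λ zs → ∑ zs G) (insertions≡ n β) ⟩
    ∑ (map (λ p → take p β ++ n ∷ drop p β) (upTo (suc (length β)))) G
      ≡⟨ ∑-map _ (upTo (suc (length β))) G ⟩
    ∑[ p ← upTo (suc (length β)) ] G (take p β ++ n ∷ drop p β)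
      ≡⟨ cong (λ l → ∑[ p ← upTo (suc l) ] G (take p β ++ n ∷ drop p β)) |β| ⟩
    ∑[ p ← upTo (suc n) ] G (take p β ++ n ∷ drop p β)
      ≡⟨ ∑-cong′ (upTo (suc n)) (λ p → only-above β p β<n) ⟩
    ∑[ p ← upTo (suc n) ] ⟦ aboveᵇ (take p β) (drop p β) ⟧ * G (take p β ++ n ∷ drop p β) ∎

layered-raise : ∀ n p a b → p ≤ n → Fits p a → Fits (n ∸ p) b → Layered (raise (n ∸ p) a) n b
layered-raise n p a b p≤n (_ , a<p) (_ , b<n-p) =
    All.map⁺ (All.map (λ {x} x<p → subst (n ∸ p + x <_) (m∸n+n≡m p≤n) (+-monoʳ-< (n ∸ p) x<p)) a<p)
  , All.map (λ y<n-p → <-≤-trans y<n-p (m∸n≤m n p)) b<n-p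
  , All.map⁺ (All.map (λ {x} _ → All.map (λ y<n-p → <-≤-trans y<n-p (m≤m+n (n ∸ p) x)) b<n-p) a<p)

contains-raise : ∀ c a τ → contains (raise c a) τ ≡ contains a τ
contains-raise c = contains-mapˡ (+-orderPreserving c)

avoids-raise : ∀ c a τ → avoids (raise c a) τ ≡ avoids a τ
avoids-raise c a τ = cong (λ b → if b then false else true) (contains-raise c a τ)

∑∑-factor : ∀ n p (T : List ℕ → List ℕ → ℕ) (g h : List ℕ → ℕ) → p ≤ n →
  (∀ {a b} → Fits p a → Fits (n ∸ p) b → T a b ≡ g a * h b) →
  ∑[ a ← perms p ] ∑[ b ← perms (n ∸ p) ] T a b ≡ (∑[ a ← perms p ] g a) * (∑[ b ← perms (n ∸ p) ] h b)
∑∑-factor n p T g h p≤n T≡ =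
  trans (∑-cong (perms p) (perms-fit p) (λ a-fits → ∑-cong (perms (n ∸ p)) (perms-fit (n ∸ p)) (λ b-fits → T≡ a-fits b-fits)))
        (∑-* (perms p) (perms (n ∸ p)) g h)

countUpTo : ℕ → ℕ → ℕ
countUpTo j = count (λ α → avoids α (upTo j))

countUpTo-zero : ∀ n → countUpTo 0 n ≡ 0
countUpTo-zero n = begin
  ∑[ α ← perms n ] ⟦ avoids α p132 ∧ avoids α [] ⟧ ≡⟨ ∑-cong′ (perms n) (λ α → cong (λ b → ⟦ avoids α p132 ∧ b ⟧) (avoids-[] α)) ⟩
  ∑[ α ← perms n ] ⟦ avoids α p132 ∧ false ⟧      ≡⟨ ∑-cong′ (perms n) (λ α → cong ⟦_⟧ (∧-zeroʳ (avoids α p132))) ⟩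
  ∑[ α ← perms n ] 0                              ≡⟨ ∑-zero (perms n) ⟩
  0                                               ∎
  where
  open ≡-Reasoning
  avoids-[] : ∀ α → avoids α [] ≡ false
  avoids-[] α = cong (λ b → if b then false else true) (contains-[] α)

countUpTo-suc : ∀ j n → countUpTo (suc j) (suc n) ≡ ∑[ p ← upTo (suc n) ] countUpTo j p * countUpTo (suc j) (n ∸ p)
countUpTo-suc j n = trans (count-suc n (λ α → avoids α (upTo (suc j))))
  (∑-cong (upTo (suc n)) (all-upTo (suc n)) (λ {p} p<1+n → ∑∑-factor n p _ _ _ (≤-pred p<1+n) (factor p (≤-pred p<1+n))))
  where
  factor : ∀ p → p ≤ n → ∀ {a b} → Fits p a → Fits (n ∸ p) b →
           ⟦ avoids (raise (n ∸ p) a ++ n ∷ b) p132 ∧ avoids (raise (n ∸ p) a ++ n ∷ b) (upTo (suc j)) ⟧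
           ≡ ⟦ avoids a p132 ∧ avoids a (upTo j) ⟧ * ⟦ avoids b p132 ∧ avoids b (upTo (suc j)) ⟧
  factor p p≤n {a} {b} a-fits b-fits = begin
    ⟦ avoids (X ++ n ∷ b) p132 ∧ avoids (X ++ n ∷ b) (upTo (suc j)) ⟧
      ≡⟨ cong ⟦_⟧ (cong₂ _∧_ (avoids-132-layered X n b L) (avoids-upTo-layered X n b j L)) ⟩
    ⟦ (avoids X p132 ∧ avoids b p132) ∧ (avoids X (upTo j) ∧ avoids b (upTo (suc j))) ⟧
      ≡⟨ cong ⟦_⟧ (∧-interchange (avoids X p132) (avoids b p132) _ _) ⟩
    ⟦ (avoids X p132 ∧ avoids X (upTo j)) ∧ (avoids b p132 ∧ avoids b (upTo (suc j))) ⟧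
      ≡⟨ cong₂ (λ u v → ⟦ (u ∧ v) ∧ (avoids b p132 ∧ avoids b (upTo (suc j))) ⟧) (avoids-raise (n ∸ p) a p132) (avoids-raise (n ∸ p) a (upTo j)) ⟩
    ⟦ (avoids a p132 ∧ avoids a (upTo j)) ∧ (avoids b p132 ∧ avoids b (upTo (suc j))) ⟧
      ≡⟨ ⟦∧⟧ (avoids a p132 ∧ avoids a (upTo j)) (avoids b p132 ∧ avoids b (upTo (suc j))) ⟩
    ⟦ avoids a p132 ∧ avoids a (upTo j) ⟧ * ⟦ avoids b p132 ∧ avoids b (upTo (suc j)) ⟧ ∎
    where
    open ≡-Reasoning
    X : List ℕ
    X = raise (n ∸ p) a
    L : Layered X n b
    L = layered-raise n p a b p≤n a-fits b-fits

avoidsBoth : List ℕ → List ℕ → Bool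
avoidsBoth τ x = avoids x p132 ∧ avoids x τ

avoiding-but-containing : (τ : List ℕ) → ℕ → ℕ → ℕ
avoiding-but-containing τ j p = ∑[ x ← perms p ] ⟦ avoidsBoth τ x ∧ contains x (upTo j) ⟧

-- A 132-avoider that avoids upTo j avoids every τ containing upTo j.
avoiding-but-containing-+ : ∀ τ j → (∀ x → contains x τ ≡ true → contains x (upTo j) ≡ true) →
                            ∀ p → avoiding-but-containing τ j p + countUpTo j p ≡ count (λ α → avoids α τ) p
avoiding-but-containing-+ τ j τ⇒upTo p =
  trans (sym (∑-+ (perms p) (λ x → ⟦ avoidsBoth τ x ∧ contains x (upTo j) ⟧) (λ x → ⟦ avoids x p132 ∧ avoids x (upTo j) ⟧)))
        (∑-cong′ (perms p) split)
  where
  split : ∀ x → ⟦ avoidsBoth τ x ∧ contains x (upTo j) ⟧ + ⟦ avoids x p132 ∧ avoids x (upTo j) ⟧ ≡ ⟦ avoidsBoth τ x ⟧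
  split x with contains x (upTo j) in x⊇upTo | contains x τ in x⊇τ | avoids x p132
  ... | true  | true  | true  = refl
  ... | true  | true  | false = refl
  ... | true  | false | true  = refl
  ... | true  | false | false = refl
  ... | false | true  | _     = case trans (sym x⊇upTo) (τ⇒upTo x x⊇τ) of λ ()
  ... | false | false | true  = refl
  ... | false | false | false = refl

indicator-split : ∀ P Q u l → ⟦ (P ∧ Q) ∧ not (u ∧ l) ⟧ + ⟦ P ∧ u ⟧ * ⟦ Q ∧ l ⟧ ≡ ⟦ P ⟧ * ⟦ Q ⟧
indicator-split false Q     u     l     = refl
indicator-split true  false u     l     = *-zeroʳ ⟦ u ⟧
indicator-split true  true  true  true  = refl
indicator-split true  true  true  false = refl
indicator-split true  true  false l     = refl

km-indicator : ∀ a m → 0 < m → let τ = kmPattern (suc (a + m)) m in ∀ n p {x y} → p ≤ n → Fits p x → Fits (n ∸ p) y →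
  ⟦ avoidsBoth τ (raise (n ∸ p) x ++ n ∷ y) ⟧ + ⟦ avoidsBoth τ x ∧ contains x (upTo a) ⟧ * ⟦ avoidsBoth τ y ∧ contains y (upTo m) ⟧
  ≡ ⟦ avoidsBoth τ x ⟧ * ⟦ avoidsBoth τ y ⟧
km-indicator a m m>0 n p {x} {y} p≤n x-fits y-fits = begin
  ⟦ avoidsBoth τ (X ++ n ∷ y) ⟧ + Cx * Cy
    ≡⟨ cong (λ b → ⟦ b ⟧ + Cx * Cy) (cong₂ _∧_ (avoids-132-layered X n y L) (avoids-km-layered X n y a m m>0 L)) ⟩
  ⟦ (avoids X p132 ∧ avoids y p132) ∧ ((avoids X τ ∧ avoids y τ) ∧ not (contains X (upTo a) ∧ contains y (upTo m))) ⟧ + Cx * Cy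
    ≡⟨ cong (λ b → ⟦ b ⟧ + Cx * Cy) (regroup (avoids X p132) (avoids y p132) (avoids X τ) (avoids y τ) _) ⟩
  ⟦ (avoidsBoth τ X ∧ avoidsBoth τ y) ∧ not (contains X (upTo a) ∧ contains y (upTo m)) ⟧ + Cx * Cy
    ≡⟨ cong₂ (λ gX uX → ⟦ (gX ∧ avoidsBoth τ y) ∧ not (uX ∧ contains y (upTo m)) ⟧ + Cx * Cy)
             (cong₂ _∧_ (avoids-raise (n ∸ p) x p132) (avoids-raise (n ∸ p) x τ)) (contains-raise (n ∸ p) x (upTo a)) ⟩
  ⟦ (avoidsBoth τ x ∧ avoidsBoth τ y) ∧ not (contains x (upTo a) ∧ contains y (upTo m)) ⟧ + Cx * Cy
    ≡⟨ indicator-split (avoidsBoth τ x) (avoidsBoth τ y) (contains x (upTo a)) (contains y (upTo m)) ⟩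
  ⟦ avoidsBoth τ x ⟧ * ⟦ avoidsBoth τ y ⟧ ∎
  where
  open ≡-Reasoning
  τ X : List ℕ
  τ = kmPattern (suc (a + m)) m
  X = raise (n ∸ p) x
  L : Layered X n y
  L = layered-raise n p x y p≤n x-fits y-fits
  Cx Cy : ℕ
  Cx = ⟦ avoidsBoth τ x ∧ contains x (upTo a) ⟧
  Cy = ⟦ avoidsBoth τ y ∧ contains y (upTo m) ⟧
  regroup : ∀ x₁ x₂ y₁ y₂ c → (x₁ ∧ x₂) ∧ ((y₁ ∧ y₂) ∧ c) ≡ ((x₁ ∧ y₁) ∧ (x₂ ∧ y₂)) ∧ c
  regroup x₁ x₂ y₁ y₂ c = solve 5 (λ x₁ x₂ y₁ y₂ c → (x₁ :* x₂) :* ((y₁ :* y₂) :* c) := ((x₁ :* y₁) :* (x₂ :* y₂)) :* c) refl x₁ x₂ y₁ y₂ c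
    where open ∨-∧-Solver

countKm-suc : ∀ a m → 0 < m → let τ = kmPattern (suc (a + m)) m in ∀ n →
  count (λ α → avoids α τ) (suc n) + (∑[ p ← upTo (suc n) ] avoiding-but-containing τ a p * avoiding-but-containing τ m (n ∸ p))
  ≡ ∑[ p ← upTo (suc n) ] count (λ α → avoids α τ) p * count (λ α → avoids α τ) (n ∸ p)
countKm-suc a m m>0 n = begin
  count (λ α → avoids α τ) (suc n) + (∑[ p ← upTo (suc n) ] C a p * C m (n ∸ p))
    ≡⟨ cong (_+ (∑[ p ← upTo (suc n) ] C a p * C m (n ∸ p))) (count-suc n (λ α → avoids α τ)) ⟩
  (∑[ p ← upTo (suc n) ] ∑∑ p summand) + (∑[ p ← upTo (suc n) ] C a p * C m (n ∸ p))
    ≡⟨ ∑-+ (upTo (suc n)) (λ p → ∑∑ p summand) (λ p → C a p * C m (n ∸ p)) ⟨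
  ∑[ p ← upTo (suc n) ] (∑∑ p summand + C a p * C m (n ∸ p))
    ≡⟨ ∑-cong (upTo (suc n)) (all-upTo (suc n)) (λ {p} p<1+n → at p (≤-pred p<1+n)) ⟩
  ∑[ p ← upTo (suc n) ] count (λ α → avoids α τ) p * count (λ α → avoids α τ) (n ∸ p) ∎
  where
  open ≡-Reasoning
  τ : List ℕ
  τ = kmPattern (suc (a + m)) m
  C : ℕ → ℕ → ℕ
  C = avoiding-but-containing τ
  ∑∑ : ℕ → (ℕ → List ℕ → List ℕ → ℕ) → ℕ
  ∑∑ p h = ∑[ x ← perms p ] ∑[ y ← perms (n ∸ p) ] h p x y
  summand : ℕ → List ℕ → List ℕ → ℕ
  summand p x y = ⟦ avoidsBoth τ (raise (n ∸ p) x ++ n ∷ y) ⟧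
  Cx Cy : List ℕ → ℕ
  Cx x = ⟦ avoidsBoth τ x ∧ contains x (upTo a) ⟧
  Cy y = ⟦ avoidsBoth τ y ∧ contains y (upTo m) ⟧
  at : ∀ p → p ≤ n → ∑∑ p summand + C a p * C m (n ∸ p) ≡ count (λ α → avoids α τ) p * count (λ α → avoids α τ) (n ∸ p)
  at p p≤n = begin
    ∑∑ p summand + C a p * C m (n ∸ p)
      ≡⟨ cong (_+_ (∑∑ p summand)) (∑-* (perms p) (perms (n ∸ p)) Cx Cy) ⟨
    ∑∑ p summand + ∑∑ p (λ _ x y → Cx x * Cy y)
      ≡⟨ ∑-+ (perms p) (λ x → ∑[ y ← perms (n ∸ p) ] summand p x y) (λ x → ∑[ y ← perms (n ∸ p) ] (Cx x * Cy y)) ⟨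
    ∑[ x ← perms p ] ((∑[ y ← perms (n ∸ p) ] summand p x y) + (∑[ y ← perms (n ∸ p) ] (Cx x * Cy y)))
      ≡⟨ ∑-cong′ (perms p) (λ x → ∑-+ (perms (n ∸ p)) (summand p x) (λ y → Cx x * Cy y)) ⟨
    ∑∑ p (λ p x y → summand p x y + Cx x * Cy y)
      ≡⟨ ∑∑-factor n p _ (λ x → ⟦ avoidsBoth τ x ⟧) (λ y → ⟦ avoidsBoth τ y ⟧) p≤n (km-indicator a m m>0 n p p≤n) ⟩
    count (λ α → avoids α τ) p * count (λ α → avoids α τ) (n ∸ p) ∎

-- Generating functions

sumℤ-convolution : ∀ F G n → sumℤ (map (λ i → F (n ∸ i) *ℤ G i) (upTo (suc n))) ≡ (G ⊗ F) n
sumℤ-convolution F G n = trans (cong sumℤ (map-upTo (λ i → F (n ∸ i) *ℤ G i) (suc n))) (go F G n)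
  where
  go : ∀ F G n → sumℤ (applyUpTo (λ i → F (n ∸ i) *ℤ G i) (suc n)) ≡ (G ⊗ F) n
  go F G zero    = trans (ℤ.+-identityʳ _) (ℤ.*-comm (F 0) (G 0))
  go F G (suc n) = cong₂ _+ℤ_ (ℤ.*-comm (F (suc n)) (G 0)) (go F (G ∘ suc) n)

coeffFV≡⊗ : ∀ τ p n → coeffFV τ p n ≡ (V p ⊗ (λ i → + f τ i)) n
coeffFV≡⊗ τ p = sumℤ-convolution (λ i → + f τ i) (V p)

m+n≡o⇒+m≡+o-+n : ∀ {x y z} → x + y ≡ z → + x ≡ + z -ℤ + y
m+n≡o⇒+m≡+o-+n {x} {y} refl = trans (x≡x+y-y (+ x) (+ y)) (cong (_-ℤ + y) (sym (ℤ.pos-+ x y)))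
  where
  x≡x+y-y : ∀ a b → a ≡ a +ℤ b -ℤ b
  x≡x+y-y = solve-∀

∑-convolution : ∀ (F G : ℕ → ℕ) n → + (∑[ p ← upTo (suc n) ] F p * G (n ∸ p)) ≡ ((+_ ∘ F) ⊗ (+_ ∘ G)) n
∑-convolution F G zero    = trans (cong +_ (+-identityʳ _)) (ℤ.pos-* (F 0) (G 0))
∑-convolution F G (suc n) = begin
  + (F 0 * G (suc n) + (∑[ p ← applyUpTo suc (suc n) ] F p * G (suc n ∸ p)))
    ≡⟨ cong (λ s → + (F 0 * G (suc n) + s)) (trans (cong (λ ps → ∑[ p ← ps ] F p * G (suc n ∸ p)) (sym (map-upTo suc (suc n))))
                                                   (∑-map suc (upTo (suc n)) (λ p → F p * G (suc n ∸ p)))) ⟩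
  + (F 0 * G (suc n) + (∑[ p ← upTo (suc n) ] F (suc p) * G (n ∸ p)))
    ≡⟨ ℤ.pos-+ (F 0 * G (suc n)) _ ⟩
  + (F 0 * G (suc n)) +ℤ + (∑[ p ← upTo (suc n) ] F (suc p) * G (n ∸ p))
    ≡⟨ cong₂ _+ℤ_ (ℤ.pos-* (F 0) (G (suc n))) (∑-convolution (F ∘ suc) G n) ⟩
  ((+_ ∘ F) ⊗ (+_ ∘ G)) (suc n) ∎
  where open ≡-Reasoning

A : ℕ → Series
A j n = + countUpTo j n

A-zero : A 0 ≋ 𝟘
A-zero n = trans (cong +_ (countUpTo-zero n)) (sym (𝟘-value n))

A-suc : ∀ j → A (suc j) ⊖ 𝕏 ⊗ (A j ⊗ A (suc j)) ≋ 𝟙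
A-suc j = ⊖𝕏⊗≋𝟙 (A (suc j)) (A j ⊗ A (suc j)) refl
  (λ n → trans (cong +_ (countUpTo-suc j n)) (∑-convolution (countUpTo j) (countUpTo (suc j)) n))

module _ (a m : ℕ) (m>0 : 0 < m) where

  private
    τ : List ℕ
    τ = kmPattern (suc (a + m)) m

  B : Series
  B n = + count (λ α → avoids α τ) n

  B-rec : B ⊖ 𝕏 ⊗ (B ⊗ B ⊖ (B ⊖ A a) ⊗ (B ⊖ A m)) ≋ 𝟙
  B-rec = ⊖𝕏⊗≋𝟙 B _ B-zero B-suc
    where
    []-avoids-τ : avoids [] τ ≡ true
    []-avoids-τ rewrite kmPattern≡ a m = refl
    B-zero : B 0 ≡ + 1
    B-zero = cong (λ b → + (⟦ b ⟧ + 0)) []-avoids-τ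
    C : ℕ → Series
    C j p = + avoiding-but-containing τ j p
    C≋B⊖A : ∀ j → (∀ x → contains x τ ≡ true → contains x (upTo j) ≡ true) → C j ≋ B ⊖ A j
    C≋B⊖A j τ⇒upTo p = m+n≡o⇒+m≡+o-+n (avoiding-but-containing-+ τ j τ⇒upTo p)
    B-suc : ∀ n → B (suc n) ≡ (B ⊗ B ⊖ (B ⊖ A a) ⊗ (B ⊖ A m)) n
    B-suc n = begin
      + count (λ α → avoids α τ) (suc n)
        ≡⟨ m+n≡o⇒+m≡+o-+n (countKm-suc a m m>0 n) ⟩
      + (∑[ p ← upTo (suc n) ] count (λ α → avoids α τ) p * count (λ α → avoids α τ) (n ∸ p))
        -ℤ + (∑[ p ← upTo (suc n) ] avoiding-but-containing τ a p * avoiding-but-containing τ m (n ∸ p))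
        ≡⟨ cong₂ _-ℤ_ (∑-convolution _ _ n) (∑-convolution _ _ n) ⟩
      (B ⊗ B) n -ℤ (C a ⊗ C m) n
        ≡⟨ cong ((B ⊗ B) n -ℤ_) (⊗-cong (C≋B⊖A a (λ x → contains-km⇒upTo-a x a m)) (C≋B⊖A m (λ x → contains-km⇒upTo-m x a m)) n) ⟩
      (B ⊗ B ⊖ (B ⊖ A a) ⊗ (B ⊖ A m)) n ∎
      where open ≡-Reasoning

  km-coefficients : ∀ n → coeffFV τ (suc (a + m)) n ≡ V (a + m) n
  km-coefficients n = begin
    coeffFV τ (suc (a + m)) n
      ≡⟨ coeffFV≡⊗ τ (suc (a + m)) n ⟩
    (V (suc (a + m)) ⊗ (λ i → + f τ i)) n
      ≡⟨ ⊗-cong (≋-sym (Ch-suc≋V (suc (a + m)))) (λ i → cong +_ (length-filterᵇ _ (perms i))) n ⟩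
    (Ch (2 + (a + m)) ⊗ B) n
      ≡⟨ ⊗-comm (Ch (2 + (a + m))) B n ⟩
    (B ⊗ Ch (2 + (a + m))) n
      ≡⟨ km-ratio a m (increasing-ratio A A-zero A-suc a) (increasing-ratio A A-zero A-suc m) B-rec n ⟩
    Ch (suc (a + m)) n
      ≡⟨ Ch-suc≋V (a + m) n ⟩
    V (a + m) n ∎
    where open ≡-Reasoning

theorem2p4 : (k m : ℕ) → 0 < m → m < k →
    (n : ℕ) → coeffFV (kmPattern k m) k n ≡ V (k ∸ 1) n
theorem2p4 k m m>0 m<k n with m≤n⇒∃[o]m+o≡n m<k
... | a , refl = subst (λ k → coeffFV (kmPattern k m) k n ≡ V (k ∸ 1) n) (cong suc (+-comm a m)) (km-coefficients a m m>0 n)
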